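{- Let $R$ be a commutative ring, $n\ge 1$, and let $A=\{a_{ij}:1\le i,j\le 2n\}$ be an alphabet of symbols indexed by pairs. Then, in the shuffle algebra $R\langle A\rangle_{\,ш\,}$, $$\sum_{\sigma\in\mathfrak S_{2n}}\epsilon(\sigma)\,a_{\sigma(1)\sigma(2)}a_{\sigma(3)\sigma(4)}\cdots a_{\sigma(2n-1)\sigma(2n)}={\rm Pf}_{\,ш\,}\big(a_{kl}-a_{lk}\big)_{1\le k,l\le 2n},$$ where $\epsilon(\sigma)$ is the signature of $\sigma$ and each term on the left is a word of length $n$ in the letters $a_{ij}$.
   Context: For an alphabet $A$, $R\langle A\rangle$ is the free $R$-module on the set of words over $A$, and the shuffle product $ш$ is the bilinear product defined recursively by $u\,ш\,1=1\,ш\,u=u$ and $au\,ш\,bv=a(u\,ш\,bv)+b(au\,ш\,v)$ for letters $a,b$ and words $u,v$; $R\langle A\rangle_{\,ш\,}$ is then a commutative associative $R$-algebra. For an antisymmetric $2n\times 2n$ matrix $M$ over a commutative ring, ${\rm Pf}(M)=\sum_{\sigma}\epsilon(\sigma)M_{\sigma(1)\sigma(2)}\cdots M_{\sigma(2n-1)\sigma(2n)}$ over $\sigma\in\mathfrak S_{2n}$ with $\sigma(2i-1)<\sigma(2i)$ for all $i$ and $\sigma(1)<\sigma(3)<\cdots<\sigma(2n-1)$. ${\rm Pf}_{\,ш\,}$ is the Pfaffian computed in $R\langle A\rangle_{\,ш\,}$. -}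

module Defs where

open import Level using (Level)
open import Algebra.Bundles using (CommutativeRing)
open import Data.Bool using (Bool; true; false; _∧_; not)
open import Data.Nat using (ℕ; zero; suc)
import Data.Nat as ℕ
open import Data.Fin using (Fin; _<?_; _≟_)
open import Data.List using (List; []; _∷_; _++_; map; concatMap; filter; length; foldr)
open import Data.Bool.ListAction using (any)
open import Data.Bool using (if_then_else_)
import Data.List.Properties
open import Data.List.Base using (allFin)
open import Data.Product using (_×_; _,_)
open import Data.Product.Properties using (≡-dec)
open import Relation.Nullary.Decidable using (does; ⌊_⌋)
open import Relation.Binary.Definitions using (DecidableEquality)

-- Permutations of {0,…,m-1}, listed as words σ(0) σ(1) … σ(m-1)

allLists : (m k : ℕ) → List (List (Fin m))
allLists m zero = [] ∷ []
allLists m (suc k) = concatMap (λ i → map (i ∷_) (allLists m k)) (allFin m)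

distinct : ∀ {m} → List (Fin m) → Bool
distinct [] = true
distinct (x ∷ xs) = not (any (λ y → ⌊ y ≟ x ⌋) xs) ∧ distinct xs

perms : (m : ℕ) → List (List (Fin m))
perms m = filter (λ σ → distinct σ Data.Bool.≟ true) (allLists m m)

inversions : ∀ {m} → List (Fin m) → ℕ
inversions [] = 0
inversions (x ∷ xs) = length (filter (λ y → y <? x) xs) ℕ.+ inversions xs

pairUp : ∀ {X : Set} → List X → List (X × X)
pairUp (x ∷ y ∷ r) = (x , y) ∷ pairUp r
pairUp _ = []

pfCond : ∀ {m} → List (Fin m × Fin m) → Bool
pfCond [] = true
pfCond ((x , y) ∷ []) = ⌊ x <? y ⌋
pfCond ((x , y) ∷ (x' , y') ∷ r) = ⌊ x <? y ⌋ ∧ ⌊ x <? x' ⌋ ∧ pfCond ((x' , y') ∷ r)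

module ShuffleAlgebra {c ℓ : Level} (R : CommutativeRing c ℓ)
                      (L : Set) (_≟L_ : DecidableEquality L) where
  open CommutativeRing R

  Word : Set
  Word = List L

  -- an element of R⟨L⟩ is a finite formal R-linear combination of words
  Poly : Set c
  Poly = List (Carrier × Word)

  wordEq? : DecidableEquality Word
  wordEq? = Data.List.Properties.≡-dec _≟L_

  coeff : Word → Poly → Carrier
  coeff w [] = 0#
  coeff w ((r , u) ∷ p) = if does (wordEq? u w) then r + coeff w p else coeff w p

  -- equality in the free module: equal coefficients on every word
  infix 4 _≋_
  _≋_ : Poly → Poly → Set ℓ
  p ≋ q = ∀ w → coeff w p ≈ coeff w q

  word : Word → Poly
  word w = (1# , w) ∷ []

  _⊕_ : Poly → Poly → Poly
  p ⊕ q = p ++ q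

  _·_ : Carrier → Poly → Poly
  r · p = map (λ { (s , w) → (r * s , w) }) p

  ⊖_ : Poly → Poly
  ⊖ p = (- 1#) · p

  sumP : List Poly → Poly
  sumP = foldr _⊕_ []

  shuffleW : Word → Word → List Word
  shuffleW [] v = v ∷ []
  shuffleW (a ∷ u) [] = (a ∷ u) ∷ []
  shuffleW (a ∷ u) (b ∷ v) =
    map (a ∷_) (shuffleW u (b ∷ v)) ++ map (b ∷_) (shuffleW (a ∷ u) v)

  _ш_ : Poly → Poly → Poly
  p ш q = concatMap (λ { (r , u) →
            concatMap (λ { (s , v) → map (λ w → (r * s , w)) (shuffleW u v) }) q }) p

  prodш : List Poly → Poly
  prodш = foldr _ш_ (word [])

  sgn : ℕ → Carrier
  sgn zero = 1#
  sgn (suc k) = - sgn k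

  Pfш : (m : ℕ) → (Fin m → Fin m → Poly) → Poly
  Pfш m M = sumP (map (λ σ → sgn (inversions σ) ·
                         prodш (map (λ { (i , j) → M i j }) (pairUp σ)))
                   (filter (λ σ → pfCond (pairUp σ) Data.Bool.≟ true) (perms m)))

Alph : ℕ → Set
Alph m = Fin m × Fin m

Alph-≟ : ∀ m → DecidableEquality (Alph m)
Alph-≟ m = ≡-dec _≟_ _≟_

{-# OPTIONS --safe #-}
module Submission where

-- Compare the coefficients of both sides at a word w = c₁ ⋯ cₙ, cᵢ = a_{xᵢ yᵢ}, and write
-- flat w = x₁ y₁ ⋯ xₙ yₙ. The left-hand side has coefficient ε(flat w) if flat w is a
-- permutation and 0 otherwise.
-- On the right, deleting a leading letter c is a derivation ∂ c of the shuffle product, so the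
-- coefficient of c w in a shuffle product of linear forms is the sum over the factors of the
-- coefficient of c in that factor times the coefficient of w in the product of the others.
-- As a_kl − a_lk (k < l) has coefficient ±1 exactly at the letters a_kl and a_lk, the product of
-- the entries of an ascending matching P has coefficient (−1)^(number of descending letters of w)
-- at w when P consists of the sorted letters of w, and 0 otherwise. Exactly one Pfaffian index
-- gives this P (its pairs ordered by first entry), and it exists iff flat w is a permutation.
-- Finally its sign times the descent sign is ε(flat w): the inversions of flat w split into
-- those inside a pair (the descents) and those between pairs, and the parity of the latter does
-- not change when the pairs are reordered or flipped.

open import Defs
open import Level using (Level)
open import Algebra.Bundles using (CommutativeRing)
open import Function using (_∘_)
open import Data.Bool using (Bool; true; false; if_then_else_; _∧_)
import Data.Bool as Bool
open import Data.Bool.ListAction using (any)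
open import Data.Nat using (ℕ; zero; suc)
import Data.Nat as ℕ
import Data.Nat.Properties as ℕ
open import Data.Nat.Tactic.RingSolver using (solve-∀)
open import Data.Fin using (Fin; _<_; _<?_; _≟_)
import Data.Fin.Properties as Fin
open import Data.List using (List; []; _∷_; _++_; map; concatMap; filter; length; foldr; allFin)
import Data.List.Properties as List
open import Data.List.Relation.Unary.All using (All; []; _∷_)
import Data.List.Relation.Unary.All as All
import Data.List.Relation.Unary.All.Properties as All
open import Data.List.Relation.Unary.AllPairs using (AllPairs; []; _∷_)
import Data.List.Relation.Unary.AllPairs as AllPairs
open import Data.List.Relation.Unary.Linked using (Linked; []; [-]; _∷_)
import Data.List.Relation.Unary.Linked as Linked
open import Data.List.Relation.Unary.Any using (here; there)
open import Data.List.Membership.Propositional using (_∈_; _∉_; _─_)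
open import Data.List.Membership.Propositional.Properties using (∈-allFin)
open import Data.List.Relation.Unary.Unique.Propositional using (Unique)
open import Data.List.Relation.Unary.Unique.Propositional.Properties using (allFin⁺)
open import Data.List.Relation.Binary.Permutation.Propositional
  using (_↭_; prep; swap; ↭-refl; ↭-sym; ↭-trans; ↭⇒↭ₛ)
import Data.List.Relation.Binary.Permutation.Propositional as ↭
import Data.List.Relation.Binary.Permutation.Propositional.Properties as ↭
import Data.List.Relation.Binary.Permutation.Setoid.Properties as ↭ₛ
open import Data.Product using (_×_; _,_; proj₁; proj₂)
open import Data.Sum using (_⊎_; inj₁; inj₂)
open import Relation.Nullary using (¬_; yes; no; does; contradiction)
open import Relation.Nullary.Decidable using (Dec; ⌊_⌋; _×-dec_; dec-true; dec-false; isYes≗does)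
open import Relation.Unary using (Pred; Decidable)
open import Relation.Binary.Definitions using (DecidableEquality; tri<; tri≈; tri>)
open import Relation.Binary.PropositionalEquality using (_≡_; _≢_)
import Relation.Binary.PropositionalEquality as ≡

picks : ∀ {a} {A : Set a} → List A → List (A × List A)
picks []       = []
picks (x ∷ xs) = (x , xs) ∷ map (λ (y , ys) → (y , x ∷ ys)) (picks xs)

module _ {a} {A : Set a} where
  open ≡ using (refl; sym)

  Unique-↭ : ∀ {xs ys : List A} → xs ↭ ys → Unique xs → Unique ys
  Unique-↭ xs↭ys = ↭ₛ.Unique-resp-↭ (≡.setoid A) (↭⇒↭ₛ xs↭ys)

  ─-↭ : ∀ {x} {xs : List A} (x∈xs : x ∈ xs) → xs ↭ x ∷ (xs ─ x∈xs)
  ─-↭ (here refl)  = ↭-refl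
  ─-↭ {xs = y ∷ xs} (there x∈xs) = ↭-trans (prep y (─-↭ x∈xs)) (swap y _ ↭-refl)

  Unique-─ : ∀ {x} {xs : List A} → Unique xs → (x∈xs : x ∈ xs) → Unique (xs ─ x∈xs)
  Unique-─ (_ ∷ unique)     (here refl)  = unique
  Unique-─ (y∉xs ∷ unique) (there x∈xs) = All.─⁺ x∈xs y∉xs ∷ Unique-─ unique x∈xs

  Unique⇒fresh-─ : ∀ {x} {xs : List A} → Unique xs → (x∈xs : x ∈ xs) → All (x ≢_) (xs ─ x∈xs)
  Unique⇒fresh-─ (x∉xs ∷ _)      (here refl)  = x∉xs
  Unique⇒fresh-─ (y∉xs ∷ unique) (there x∈xs) =
    (λ x≡y → All.lookup y∉xs x∈xs (sym x≡y)) ∷ Unique⇒fresh-─ unique x∈xs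

module ListSum {c ℓ} (R : CommutativeRing c ℓ) where
  open CommutativeRing R
  open import Relation.Binary.Reasoning.Setoid setoid
  open import Algebra.Properties.CommutativeSemigroup +-commutativeSemigroup using (interchange)

  private variable
    a b : Level
    A : Set a
    B : Set b

  ∑ : List A → (A → Carrier) → Carrier
  ∑ []       f = 0#
  ∑ (x ∷ xs) f = f x + ∑ xs f

  infix 5 ∑
  syntax ∑ xs (λ x → e) = ∑[ x ∈ xs ] e

  when : Bool → Carrier → Carrier
  when b x = if b then x else 0#

  when-≟-true : ∀ b x → (if does (b Bool.≟ true) then x else 0#) ≈ when b x
  when-≟-true true  x = refl
  when-≟-true false x = refl

  ∑-cong : ∀ xs {f g : A → Carrier} → (∀ x → f x ≈ g x) → ∑ xs f ≈ ∑ xs g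
  ∑-cong []       f≈g = refl
  ∑-cong (x ∷ xs) f≈g = +-cong (f≈g x) (∑-cong xs f≈g)

  ∑-zero : ∀ xs {f : A → Carrier} → (∀ {x} → x ∈ xs → f x ≈ 0#) → ∑ xs f ≈ 0#
  ∑-zero []       f≈0 = refl
  ∑-zero (x ∷ xs) f≈0 = trans (+-cong (f≈0 (here ≡.refl)) (∑-zero xs (f≈0 ∘ there))) (+-identityˡ 0#)

  ∑-single : ∀ {xs} {j} {f : A → Carrier} → Unique xs → j ∈ xs →
             (∀ {x} → x ∈ xs → x ≢ j → f x ≈ 0#) → ∑ xs f ≈ f j
  ∑-single {xs = x ∷ xs} (x∉xs ∷ _) (here ≡.refl) f≈0 =
    trans (+-congˡ (∑-zero xs (λ x∈xs → f≈0 (there x∈xs) (λ { ≡.refl → All.lookup x∉xs x∈xs ≡.refl }))))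
          (+-identityʳ _)
  ∑-single {xs = x ∷ xs} (x∉xs ∷ unique) (there j∈xs) f≈0 =
    trans (+-cong (f≈0 (here ≡.refl) (λ { ≡.refl → All.lookup x∉xs j∈xs ≡.refl }))
                  (∑-single unique j∈xs (f≈0 ∘ there)))
          (+-identityˡ _)

  ∑-++ : ∀ xs ys (f : A → Carrier) → ∑ (xs ++ ys) f ≈ ∑ xs f + ∑ ys f
  ∑-++ []       ys f = sym (+-identityˡ _)
  ∑-++ (x ∷ xs) ys f = trans (+-congˡ (∑-++ xs ys f)) (sym (+-assoc _ _ _))

  ∑-+ : ∀ xs (f g : A → Carrier) → ∑[ x ∈ xs ] (f x + g x) ≈ ∑ xs f + ∑ xs g
  ∑-+ []       f g = sym (+-identityˡ 0#)
  ∑-+ (x ∷ xs) f g = trans (+-congˡ (∑-+ xs f g)) (interchange _ _ _ _)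

  ∑-*ˡ : ∀ xs k (f : A → Carrier) → ∑[ x ∈ xs ] (k * f x) ≈ k * ∑ xs f
  ∑-*ˡ []       k f = sym (zeroʳ k)
  ∑-*ˡ (x ∷ xs) k f = trans (+-congˡ (∑-*ˡ xs k f)) (sym (distribˡ k _ _))

  ∑-*ʳ : ∀ xs k (f : A → Carrier) → ∑[ x ∈ xs ] (f x * k) ≈ ∑ xs f * k
  ∑-*ʳ []       k f = sym (zeroˡ k)
  ∑-*ʳ (x ∷ xs) k f = trans (+-congˡ (∑-*ʳ xs k f)) (sym (distribʳ k _ _))

  ∑-filter : ∀ {p} {P : Pred A p} (P? : Decidable P) xs (f : A → Carrier) →
           ∑ (filter P? xs) f ≈ ∑[ x ∈ xs ] (if does (P? x) then f x else 0#)
  ∑-filter P? []       f = refl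
  ∑-filter P? (x ∷ xs) f with does (P? x)
  ... | true  = +-congˡ (∑-filter P? xs f)
  ... | false = trans (∑-filter P? xs f) (sym (+-identityˡ _))

  ∑-map : ∀ xs (g : A → B) (f : B → Carrier) → ∑ (map g xs) f ≡ ∑[ x ∈ xs ] f (g x)
  ∑-map []       g f = ≡.refl
  ∑-map (x ∷ xs) g f = ≡.cong (f (g x) +_) (∑-map xs g f)

  ∑-concatMap : ∀ xs (g : A → List B) (f : B → Carrier) →
                ∑ (concatMap g xs) f ≈ ∑[ x ∈ xs ] ∑ (g x) f
  ∑-concatMap []       g f = refl
  ∑-concatMap (x ∷ xs) g f = trans (∑-++ (g x) (concatMap g xs) f) (+-congˡ (∑-concatMap xs g f))

  ∑-comm : ∀ xs ys (f : A → B → Carrier) →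
           ∑[ x ∈ xs ] ∑[ y ∈ ys ] f x y ≈ ∑[ y ∈ ys ] ∑[ x ∈ xs ] f x y
  ∑-comm []       ys f = sym (∑-zero ys (λ _ → refl))
  ∑-comm (x ∷ xs) ys f = trans (+-congˡ (∑-comm xs ys f)) (sym (∑-+ ys (f x) _))

  ∑-picks-∷ : ∀ x xs (g : A → Carrier) (f : List A → Carrier) →
             ∑ (picks (x ∷ xs)) (λ (y , ys) → g y * f ys) ≡
             g x * f xs + ∑ (picks xs) (λ (y , ys) → g y * f (x ∷ ys))
  ∑-picks-∷ x xs g f = ≡.cong (g x * f xs +_) (∑-map (picks xs) (λ (y , ys) → (y , x ∷ ys)) _)

  ∑-picks-zero : ∀ {xs} {g : A → Carrier} (f : List A → Carrier) → All (λ x → g x ≈ 0#) xs →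
                 ∑ (picks xs) (λ (x , ys) → g x * f ys) ≈ 0#
  ∑-picks-zero f [] = refl
  ∑-picks-zero {xs = x ∷ xs} {g} f (gx≈0 ∷ gxs≈0) = begin
    ∑ (picks (x ∷ xs)) (λ (y , ys) → g y * f ys)                ≡⟨ ∑-picks-∷ x xs g f ⟩
    g x * f xs + ∑ (picks xs) (λ (y , ys) → g y * f (x ∷ ys))
      ≈⟨ +-cong (trans (*-congʳ gx≈0) (zeroˡ _)) (∑-picks-zero (f ∘ (x ∷_)) gxs≈0) ⟩
    0# + 0#                                                      ≈⟨ +-identityˡ 0# ⟩
    0#                                                           ∎

  ∑-picks-∈ : ∀ {xs} {e} {g : A → Carrier} (f : List A → Carrier) (e∈xs : e ∈ xs) →
              All (λ x → g x ≈ 0#) (xs ─ e∈xs) →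
              ∑ (picks xs) (λ (x , ys) → g x * f ys) ≈ g e * f (xs ─ e∈xs)
  ∑-picks-∈ {xs = x ∷ xs} {g = g} f (here ≡.refl) gxs≈0 = begin
    ∑ (picks (x ∷ xs)) (λ (y , ys) → g y * f ys)                ≡⟨ ∑-picks-∷ x xs g f ⟩
    g x * f xs + ∑ (picks xs) (λ (y , ys) → g y * f (x ∷ ys))    ≈⟨ +-congˡ (∑-picks-zero (f ∘ (x ∷_)) gxs≈0) ⟩
    g x * f xs + 0#                                              ≈⟨ +-identityʳ _ ⟩
    g x * f xs                                                   ∎
  ∑-picks-∈ {xs = x ∷ xs} {e} {g} f (there e∈xs) (gx≈0 ∷ gxs≈0) = begin
    ∑ (picks (x ∷ xs)) (λ (y , ys) → g y * f ys)                ≡⟨ ∑-picks-∷ x xs g f ⟩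
    g x * f xs + ∑ (picks xs) (λ (y , ys) → g y * f (x ∷ ys))
      ≈⟨ +-cong (trans (*-congʳ gx≈0) (zeroˡ _)) (∑-picks-∈ (f ∘ (x ∷_)) e∈xs gxs≈0) ⟩
    0# + g e * f (x ∷ (xs ─ e∈xs))                               ≈⟨ +-identityˡ _ ⟩
    g e * f (x ∷ (xs ─ e∈xs))                                    ∎

module ShuffleCalculus {c ℓ} (R : CommutativeRing c ℓ) (L : Set) (_≟L_ : DecidableEquality L) where
  open CommutativeRing R
  open ShuffleAlgebra R L _≟L_
  open ListSum R
  open import Relation.Binary.Reasoning.Setoid setoid
  open import Algebra.Properties.CommutativeSemigroup *-commutativeSemigroup
    using (x∙yz≈y∙xz; interchange)
  open import Algebra.Properties.Ring ring using (-‿distribˡ-*; -‿distribʳ-*; -‿involutive)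

  δ : Word → Word → Carrier
  δ w u = if does (wordEq? u w) then 1# else 0#

  count : Word → List Word → Carrier
  count w us = ∑[ u ∈ us ] δ w u

  coeff-as-∑ : ∀ w p → coeff w p ≈ ∑ p (λ (r , u) → r * δ w u)
  coeff-as-∑ w []            = refl
  coeff-as-∑ w ((r , u) ∷ p) with does (wordEq? u w)
  ... | true  = +-cong (sym (*-identityʳ r)) (coeff-as-∑ w p)
  ... | false = trans (coeff-as-∑ w p) (trans (sym (+-identityˡ _)) (+-congʳ (sym (zeroʳ r))))

  coeff-++ : ∀ w p q → coeff w (p ++ q) ≈ coeff w p + coeff w q
  coeff-++ w p q = begin
    coeff w (p ++ q)                              ≈⟨ coeff-as-∑ w (p ++ q) ⟩
    ∑ (p ++ q) (λ (r , u) → r * δ w u)            ≈⟨ ∑-++ p q _ ⟩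
    ∑ p (λ (r , u) → r * δ w u) + ∑ q (λ (r , u) → r * δ w u)
                                                  ≈⟨ +-cong (coeff-as-∑ w p) (coeff-as-∑ w q) ⟨
    coeff w p + coeff w q                         ∎

  coeff-· : ∀ w k p → coeff w (k · p) ≈ k * coeff w p
  coeff-· w k []            = sym (zeroʳ k)
  coeff-· w k ((r , u) ∷ p) with does (wordEq? u w)
  ... | true  = trans (+-congˡ (coeff-· w k p)) (sym (distribˡ k r _))
  ... | false = coeff-· w k p

  coeff-sumP : ∀ w ps → coeff w (sumP ps) ≈ ∑[ p ∈ ps ] coeff w p
  coeff-sumP w []       = refl
  coeff-sumP w (p ∷ ps) = trans (coeff-++ w p (sumP ps)) (+-congˡ (coeff-sumP w ps))

  coeff-sumP-· : ∀ {a} {A : Set a} w (xs : List A) (k : A → Carrier) (f : A → Poly) →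
                 coeff w (sumP (map (λ x → k x · f x) xs)) ≈ ∑[ x ∈ xs ] k x * coeff w (f x)
  coeff-sumP-· w xs k f = begin
    coeff w (sumP (map (λ x → k x · f x) xs))   ≈⟨ coeff-sumP w (map (λ x → k x · f x) xs) ⟩
    ∑ (map (λ x → k x · f x) xs) (coeff w)       ≡⟨ ∑-map xs (λ x → k x · f x) (coeff w) ⟩
    ∑[ x ∈ xs ] coeff w (k x · f x)               ≈⟨ ∑-cong xs (λ x → coeff-· w (k x) (f x)) ⟩
    ∑[ x ∈ xs ] k x * coeff w (f x)               ∎

  δ-∷-∷ : ∀ c w a u → δ (c ∷ w) (a ∷ u) ≈ (if does (a ≟L c) then δ w u else 0#)
  δ-∷-∷ c w a u with a ≟L c
  ... | yes _ = refl
  ... | no  _ = refl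

  ∑-if : ∀ {a} {A : Set a} b (xs : List A) (f : A → Carrier) →
         ∑[ x ∈ xs ] (if b then f x else 0#) ≈ (if b then ∑ xs f else 0#)
  ∑-if true  xs f = refl
  ∑-if false xs f = ∑-zero xs (λ _ → refl)

  count-map-∷ : ∀ c w a us → count (c ∷ w) (map (a ∷_) us) ≈ (if does (a ≟L c) then count w us else 0#)
  count-map-∷ c w a us = begin
    count (c ∷ w) (map (a ∷_) us)                        ≡⟨ ∑-map us (a ∷_) (δ (c ∷ w)) ⟩
    ∑[ u ∈ us ] δ (c ∷ w) (a ∷ u)                          ≈⟨ ∑-cong us (δ-∷-∷ c w a) ⟩
    ∑[ u ∈ us ] (if does (a ≟L c) then δ w u else 0#)      ≈⟨ ∑-if (does (a ≟L c)) us (δ w) ⟩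
    (if does (a ≟L c) then count w us else 0#)            ∎

  ∂W : L → Word → List Word
  ∂W c []      = []
  ∂W c (a ∷ u) = if does (a ≟L c) then u ∷ [] else []

  ∂ : L → Poly → Poly
  ∂ c p = concatMap (λ (r , u) → map (r ,_) (∂W c u)) p

  ∑-∂W-∷ : ∀ c a u (f : Word → Carrier) → ∑ (∂W c (a ∷ u)) f ≈ (if does (a ≟L c) then f u else 0#)
  ∑-∂W-∷ c a u f with does (a ≟L c)
  ... | true  = +-identityʳ (f u)
  ... | false = refl

  δ-∷ : ∀ c w u → δ (c ∷ w) u ≈ count w (∂W c u)
  δ-∷ c w []      = refl
  δ-∷ c w (a ∷ u) = trans (δ-∷-∷ c w a u) (sym (∑-∂W-∷ c a u (δ w)))

  coeff-∂ : ∀ c w p → coeff w (∂ c p) ≈ coeff (c ∷ w) p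
  coeff-∂ c w p = begin
    coeff w (∂ c p)                                                   ≈⟨ coeff-as-∑ w (∂ c p) ⟩
    ∑ (∂ c p) (λ (s , v) → s * δ w v)                                 ≈⟨ ∑-concatMap p _ _ ⟩
    ∑ p (λ (r , u) → ∑ (map (r ,_) (∂W c u)) (λ (s , v) → s * δ w v))
      ≈⟨ ∑-cong p (λ (r , u) → trans (reflexive (∑-map (∂W c u) (r ,_) _)) (∑-*ˡ (∂W c u) r (δ w))) ⟩
    ∑ p (λ (r , u) → r * count w (∂W c u))
      ≈⟨ ∑-cong p (λ (r , u) → *-congˡ (δ-∷ c w u)) ⟨
    ∑ p (λ (r , u) → r * δ (c ∷ w) u)                                 ≈⟨ coeff-as-∑ (c ∷ w) p ⟨
    coeff (c ∷ w) p                                                   ∎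

  count-[-] : ∀ w u → count w (u ∷ []) ≈ δ w u
  count-[-] w u = +-identityʳ (δ w u)

  shuffleW-[]ʳ : ∀ u → shuffleW u [] ≡ u ∷ []
  shuffleW-[]ʳ []      = ≡.refl
  shuffleW-[]ʳ (a ∷ u) = ≡.refl

  count-shuffleW-∷ : ∀ c w u v → count (c ∷ w) (shuffleW u v) ≈
    (∑[ u' ∈ ∂W c u ] count w (shuffleW u' v)) + (∑[ v' ∈ ∂W c v ] count w (shuffleW u v'))
  count-shuffleW-∷ c w [] v = begin
    count (c ∷ w) (v ∷ [])                        ≈⟨ count-[-] (c ∷ w) v ⟩
    δ (c ∷ w) v                                   ≈⟨ δ-∷ c w v ⟩
    ∑[ v' ∈ ∂W c v ] δ w v'                       ≈⟨ ∑-cong (∂W c v) (count-[-] w) ⟨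
    ∑[ v' ∈ ∂W c v ] count w (v' ∷ [])            ≈⟨ +-identityˡ _ ⟨
    0# + (∑[ v' ∈ ∂W c v ] count w (v' ∷ []))     ∎
  count-shuffleW-∷ c w (a ∷ u) [] = begin
    count (c ∷ w) ((a ∷ u) ∷ [])                        ≈⟨ count-[-] (c ∷ w) (a ∷ u) ⟩
    δ (c ∷ w) (a ∷ u)                                   ≈⟨ δ-∷ c w (a ∷ u) ⟩
    ∑[ u' ∈ ∂W c (a ∷ u) ] δ w u'                       ≈⟨ ∑-cong (∂W c (a ∷ u)) shuffled ⟨
    ∑[ u' ∈ ∂W c (a ∷ u) ] count w (shuffleW u' [])     ≈⟨ +-identityʳ _ ⟨
    (∑[ u' ∈ ∂W c (a ∷ u) ] count w (shuffleW u' [])) + 0# ∎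
    where
    shuffled : ∀ u' → count w (shuffleW u' []) ≈ δ w u'
    shuffled u' = trans (reflexive (≡.cong (count w) (shuffleW-[]ʳ u'))) (count-[-] w u')
  count-shuffleW-∷ c w (a ∷ u) (b ∷ v) = begin
    count (c ∷ w) (map (a ∷_) (shuffleW u (b ∷ v)) ++ map (b ∷_) (shuffleW (a ∷ u) v))
      ≈⟨ ∑-++ (map (a ∷_) (shuffleW u (b ∷ v))) _ (δ (c ∷ w)) ⟩
    count (c ∷ w) (map (a ∷_) (shuffleW u (b ∷ v))) + count (c ∷ w) (map (b ∷_) (shuffleW (a ∷ u) v))
      ≈⟨ +-cong (count-map-∷ c w a (shuffleW u (b ∷ v))) (count-map-∷ c w b (shuffleW (a ∷ u) v)) ⟩
    (if does (a ≟L c) then count w (shuffleW u (b ∷ v)) else 0#) +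
    (if does (b ≟L c) then count w (shuffleW (a ∷ u) v) else 0#)
      ≈⟨ +-cong (∑-∂W-∷ c a u _) (∑-∂W-∷ c b v _) ⟨
    (∑[ u' ∈ ∂W c (a ∷ u) ] count w (shuffleW u' (b ∷ v))) +
    (∑[ v' ∈ ∂W c (b ∷ v) ] count w (shuffleW (a ∷ u) v'))
      ∎

  count-shuffleW-[] : ∀ u v → count [] (shuffleW u v) ≈ δ [] u * δ [] v
  count-shuffleW-[] []      []      = trans (+-identityʳ 1#) (sym (*-identityʳ 1#))
  count-shuffleW-[] []      (b ∷ v) = trans (+-identityʳ 0#) (sym (zeroʳ 1#))
  count-shuffleW-[] (a ∷ u) []      = trans (+-identityʳ 0#) (sym (zeroˡ 1#))
  count-shuffleW-[] (a ∷ u) (b ∷ v) = begin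
    count [] (map (a ∷_) (shuffleW u (b ∷ v)) ++ map (b ∷_) (shuffleW (a ∷ u) v))
      ≈⟨ ∑-++ (map (a ∷_) (shuffleW u (b ∷ v))) _ (δ []) ⟩
    count [] (map (a ∷_) (shuffleW u (b ∷ v))) + count [] (map (b ∷_) (shuffleW (a ∷ u) v))
      ≈⟨ +-cong (nonEmpty a (shuffleW u (b ∷ v))) (nonEmpty b (shuffleW (a ∷ u) v)) ⟩
    0# + 0#
      ≈⟨ +-identityʳ 0# ⟩
    0#
      ≈⟨ zeroˡ 0# ⟨
    0# * 0# ∎
    where
    nonEmpty : ∀ x us → count [] (map (x ∷_) us) ≈ 0#
    nonEmpty x us = trans (reflexive (∑-map us (x ∷_) (δ []))) (∑-zero us (λ _ → refl))

  bilinear : (Word → Word → Carrier) → Poly → Poly → Carrier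
  bilinear K p q = ∑ p (λ (r , u) → ∑ q (λ (s , v) → (r * s) * K u v))

  coeff-ш : ∀ w p q → coeff w (p ш q) ≈ bilinear (λ u v → count w (shuffleW u v)) p q
  coeff-ш w p q = begin
    coeff w (p ш q)
      ≈⟨ coeff-as-∑ w (p ш q) ⟩
    ∑ (p ш q) (λ (t , x) → t * δ w x)
      ≈⟨ ∑-concatMap p _ _ ⟩
    ∑ p (λ (r , u) → ∑ (concatMap (λ (s , v) → map ((r * s) ,_) (shuffleW u v)) q) (λ (t , x) → t * δ w x))
      ≈⟨ ∑-cong p (λ (r , u) → trans (∑-concatMap q _ _) (∑-cong q (λ (s , v) → inner r u s v))) ⟩
    bilinear (λ u v → count w (shuffleW u v)) p q ∎
    where
    inner : ∀ r u s v →
            ∑ (map ((r * s) ,_) (shuffleW u v)) (λ (t , x) → t * δ w x) ≈ (r * s) * count w (shuffleW u v)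
    inner r u s v = trans (reflexive (∑-map (shuffleW u v) ((r * s) ,_) _)) (∑-*ˡ (shuffleW u v) (r * s) (δ w))

  module _ (K : Word → Word → Carrier) where

    bilinear-cong : ∀ {K'} p q → (∀ u v → K u v ≈ K' u v) → bilinear K p q ≈ bilinear K' p q
    bilinear-cong p q K≈K' = ∑-cong p (λ (r , u) → ∑-cong q (λ (s , v) → *-congˡ (K≈K' u v)))

    bilinear-+ : ∀ K' p q → bilinear (λ u v → K u v + K' u v) p q ≈ bilinear K p q + bilinear K' p q
    bilinear-+ K' p q = begin
      bilinear (λ u v → K u v + K' u v) p q
        ≈⟨ ∑-cong p (λ (r , u) → ∑-cong q (λ (s , v) → distribˡ (r * s) (K u v) (K' u v))) ⟩
      ∑ p (λ (r , u) → ∑ q (λ (s , v) → (r * s) * K u v + (r * s) * K' u v))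
        ≈⟨ ∑-cong p (λ (r , u) → ∑-+ q _ _) ⟩
      ∑ p (λ (r , u) → ∑ q (λ (s , v) → (r * s) * K u v) + ∑ q (λ (s , v) → (r * s) * K' u v))
        ≈⟨ ∑-+ p _ _ ⟩
      bilinear K p q + bilinear K' p q ∎

    bilinear-++ʳ : ∀ p q q' → bilinear K p (q ++ q') ≈ bilinear K p q + bilinear K p q'
    bilinear-++ʳ p q q' = trans (∑-cong p (λ (r , u) → ∑-++ q q' _)) (∑-+ p _ _)

    bilinear-·ʳ : ∀ p k q → bilinear K p (k · q) ≈ k * bilinear K p q
    bilinear-·ʳ p k q = trans (∑-cong p inner) (∑-*ˡ p k _)
      where
      inner : ∀ ((r , u) : Carrier × Word) →
              ∑ (k · q) (λ (s , v) → (r * s) * K u v) ≈ k * ∑ q (λ (s , v) → (r * s) * K u v)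
      inner (r , u) = begin
        ∑ (k · q) (λ (s , v) → (r * s) * K u v)    ≡⟨ ∑-map q _ _ ⟩
        ∑ q (λ (s , v) → (r * (k * s)) * K u v)
          ≈⟨ ∑-cong q (λ (s , v) → trans (*-congʳ (x∙yz≈y∙xz r k s)) (*-assoc k _ _)) ⟩
        ∑ q (λ (s , v) → k * ((r * s) * K u v))    ≈⟨ ∑-*ˡ q k _ ⟩
        k * ∑ q (λ (s , v) → (r * s) * K u v)      ∎

    bilinear-∂ˡ : ∀ c p q → bilinear K (∂ c p) q ≈ bilinear (λ u v → ∑[ u' ∈ ∂W c u ] K u' v) p q
    bilinear-∂ˡ c p q = begin
      bilinear K (∂ c p) q
        ≈⟨ ∑-concatMap p _ _ ⟩
      ∑ p (λ (r , u) → ∑ (map (r ,_) (∂W c u)) (λ (r' , u') → ∑ q (λ (s , v) → (r' * s) * K u' v)))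
        ≈⟨ ∑-cong p (λ (r , u) → reflexive (∑-map (∂W c u) (r ,_) _)) ⟩
      ∑ p (λ (r , u) → ∑[ u' ∈ ∂W c u ] ∑ q (λ (s , v) → (r * s) * K u' v))
        ≈⟨ ∑-cong p (λ (r , u) → ∑-comm (∂W c u) q _) ⟩
      ∑ p (λ (r , u) → ∑ q (λ (s , v) → ∑[ u' ∈ ∂W c u ] (r * s) * K u' v))
        ≈⟨ ∑-cong p (λ (r , u) → ∑-cong q (λ (s , v) → ∑-*ˡ (∂W c u) (r * s) _)) ⟩
      bilinear (λ u v → ∑[ u' ∈ ∂W c u ] K u' v) p q ∎

    bilinear-∂ʳ : ∀ c p q → bilinear K p (∂ c q) ≈ bilinear (λ u v → ∑[ v' ∈ ∂W c v ] K u v') p q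
    bilinear-∂ʳ c p q = ∑-cong p inner
      where
      inner : ∀ ((r , u) : Carrier × Word) → ∑ (∂ c q) (λ (s , v') → (r * s) * K u v') ≈
                                              ∑ q (λ (s , v) → (r * s) * (∑[ v' ∈ ∂W c v ] K u v'))
      inner (r , u) = begin
        ∑ (∂ c q) (λ (s , v') → (r * s) * K u v')
          ≈⟨ ∑-concatMap q _ _ ⟩
        ∑ q (λ (s , v) → ∑ (map (s ,_) (∂W c v)) (λ (s' , v') → (r * s') * K u v'))
          ≈⟨ ∑-cong q (λ (s , v) → trans (reflexive (∑-map (∂W c v) (s ,_) _)) (∑-*ˡ (∂W c v) (r * s) _)) ⟩
        ∑ q (λ (s , v) → (r * s) * (∑[ v' ∈ ∂W c v ] K u v')) ∎

  ∂-cong : ∀ c p q → p ≋ q → ∂ c p ≋ ∂ c q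
  ∂-cong c p q p≋q w = trans (coeff-∂ c w p) (trans (p≋q (c ∷ w)) (sym (coeff-∂ c w q)))

  ш-[]ʳ : ∀ p → p ш [] ≋ []
  ш-[]ʳ p w = trans (coeff-ш w p []) (∑-zero p (λ _ → refl))

  ш-++ʳ : ∀ p q q' → p ш (q ++ q') ≋ (p ш q) ⊕ (p ш q')
  ш-++ʳ p q q' w = begin
    coeff w (p ш (q ++ q'))                    ≈⟨ coeff-ш w p (q ++ q') ⟩
    bilinear _ p (q ++ q')                     ≈⟨ bilinear-++ʳ _ p q q' ⟩
    bilinear _ p q + bilinear _ p q'           ≈⟨ +-cong (coeff-ш w p q) (coeff-ш w p q') ⟨
    coeff w (p ш q) + coeff w (p ш q')         ≈⟨ coeff-++ w (p ш q) (p ш q') ⟨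
    coeff w ((p ш q) ⊕ (p ш q'))               ∎

  ш-·ʳ : ∀ p k q → p ш (k · q) ≋ k · (p ш q)
  ш-·ʳ p k q w = begin
    coeff w (p ш (k · q))                      ≈⟨ coeff-ш w p (k · q) ⟩
    bilinear _ p (k · q)                       ≈⟨ bilinear-·ʳ _ p k q ⟩
    k * bilinear _ p q                         ≈⟨ *-congˡ (coeff-ш w p q) ⟨
    k * coeff w (p ш q)                        ≈⟨ coeff-· w k (p ш q) ⟨
    coeff w (k · (p ш q))                      ∎

  coeff-[]-ш : ∀ p q → coeff [] (p ш q) ≈ coeff [] p * coeff [] q
  coeff-[]-ш p q = begin
    coeff [] (p ш q)
      ≈⟨ coeff-ш [] p q ⟩
    bilinear (λ u v → count [] (shuffleW u v)) p q
      ≈⟨ bilinear-cong _ p q count-shuffleW-[] ⟩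
    ∑ p (λ (r , u) → ∑ q (λ (s , v) → (r * s) * (δ [] u * δ [] v)))
      ≈⟨ ∑-cong p (λ (r , u) → ∑-cong q (λ (s , v) → interchange r s (δ [] u) (δ [] v))) ⟩
    ∑ p (λ (r , u) → ∑ q (λ (s , v) → (r * δ [] u) * (s * δ [] v)))
      ≈⟨ ∑-cong p (λ (r , u) → ∑-*ˡ q (r * δ [] u) _) ⟩
    ∑ p (λ (r , u) → (r * δ [] u) * ∑ q (λ (s , v) → s * δ [] v))
      ≈⟨ ∑-*ʳ p _ _ ⟩
    ∑ p (λ (r , u) → r * δ [] u) * ∑ q (λ (s , v) → s * δ [] v)
      ≈⟨ *-cong (coeff-as-∑ [] p) (coeff-as-∑ [] q) ⟨
    coeff [] p * coeff [] q ∎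

  ∂-ш : ∀ c p q → ∂ c (p ш q) ≋ (∂ c p ш q) ⊕ (p ш ∂ c q)
  ∂-ш c p q w = begin
    coeff w (∂ c (p ш q))
      ≈⟨ coeff-∂ c w (p ш q) ⟩
    coeff (c ∷ w) (p ш q)
      ≈⟨ coeff-ш (c ∷ w) p q ⟩
    bilinear (λ u v → count (c ∷ w) (shuffleW u v)) p q
      ≈⟨ bilinear-cong _ p q (count-shuffleW-∷ c w) ⟩
    bilinear (λ u v → (∑[ u' ∈ ∂W c u ] K u' v) + (∑[ v' ∈ ∂W c v ] K u v')) p q
      ≈⟨ bilinear-+ _ _ p q ⟩
    bilinear (λ u v → ∑[ u' ∈ ∂W c u ] K u' v) p q + bilinear (λ u v → ∑[ v' ∈ ∂W c v ] K u v') p q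
      ≈⟨ +-cong (bilinear-∂ˡ K c p q) (bilinear-∂ʳ K c p q) ⟨
    bilinear K (∂ c p) q + bilinear K p (∂ c q)
      ≈⟨ +-cong (coeff-ш w (∂ c p) q) (coeff-ш w p (∂ c q)) ⟨
    coeff w (∂ c p ш q) + coeff w (p ш ∂ c q)
      ≈⟨ coeff-++ w (∂ c p ш q) (p ш ∂ c q) ⟨
    coeff w ((∂ c p ш q) ⊕ (p ш ∂ c q)) ∎
    where
    K : Word → Word → Carrier
    K u v = count w (shuffleW u v)

  -- ≋ only compares coefficients, so congruence goes by induction on the word through ∂-ш.
  ш-congʳ : ∀ p q q' → q ≋ q' → p ш q ≋ p ш q'
  ш-congʳ p q q' q≋q' [] =
    trans (coeff-[]-ш p q) (trans (*-congˡ (q≋q' [])) (sym (coeff-[]-ш p q')))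
  ш-congʳ p q q' q≋q' (c ∷ w) = begin
    coeff (c ∷ w) (p ш q)                       ≈⟨ coeff-∂ c w (p ш q) ⟨
    coeff w (∂ c (p ш q))                       ≈⟨ ∂-ш c p q w ⟩
    coeff w ((∂ c p ш q) ⊕ (p ш ∂ c q))         ≈⟨ coeff-++ w (∂ c p ш q) (p ш ∂ c q) ⟩
    coeff w (∂ c p ш q) + coeff w (p ш ∂ c q)
      ≈⟨ +-cong (ш-congʳ (∂ c p) q q' q≋q' w) (ш-congʳ p (∂ c q) (∂ c q') (∂-cong c q q' q≋q') w) ⟩
    coeff w (∂ c p ш q') + coeff w (p ш ∂ c q') ≈⟨ coeff-++ w (∂ c p ш q') (p ш ∂ c q') ⟨
    coeff w ((∂ c p ш q') ⊕ (p ш ∂ c q'))       ≈⟨ ∂-ш c p q' w ⟨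
    coeff w (∂ c (p ш q'))                      ≈⟨ coeff-∂ c w (p ш q') ⟩
    coeff (c ∷ w) (p ш q')                      ∎

  ш-sumP-·ʳ : ∀ {a} {A : Set a} p (xs : List A) (k : A → Carrier) (f : A → Poly) →
              p ш sumP (map (λ x → k x · f x) xs) ≋ sumP (map (λ x → k x · (p ш f x)) xs)
  ш-sumP-·ʳ p []       k f = ш-[]ʳ p
  ш-sumP-·ʳ p (x ∷ xs) k f w = begin
    coeff w (p ш ((k x · f x) ⊕ rest))              ≈⟨ ш-++ʳ p (k x · f x) rest w ⟩
    coeff w ((p ш (k x · f x)) ⊕ (p ш rest))        ≈⟨ coeff-++ w (p ш (k x · f x)) (p ш rest) ⟩
    coeff w (p ш (k x · f x)) + coeff w (p ш rest)  ≈⟨ +-cong (ш-·ʳ p (k x) (f x) w) (ш-sumP-·ʳ p xs k f w) ⟩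
    coeff w (k x · (p ш f x)) + coeff w rest'       ≈⟨ coeff-++ w (k x · (p ш f x)) rest' ⟨
    coeff w ((k x · (p ш f x)) ⊕ rest')             ∎
    where
    rest rest' : Poly
    rest  = sumP (map (λ y → k y · f y) xs)
    rest' = sumP (map (λ y → k y · (p ш f y)) xs)

  Homogeneous : ℕ → Poly → Set c
  Homogeneous d p = All (λ (_ , u) → length u ≡ d) p

  ∂-homogeneous : ∀ c d {p} → Homogeneous (suc d) p → Homogeneous d (∂ c p)
  ∂-homogeneous c d {[]}                  []          = []
  ∂-homogeneous c d {(r , a ∷ u) ∷ p} (≡.refl ∷ hp) with does (a ≟L c)
  ... | true  = ≡.refl ∷ ∂-homogeneous c d hp
  ... | false = ∂-homogeneous c d hp

  coeff-[]-homogeneous : ∀ d {p} → Homogeneous (suc d) p → coeff [] p ≈ 0#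
  coeff-[]-homogeneous d {[]}                []          = refl
  coeff-[]-homogeneous d {(r , a ∷ u) ∷ p} (≡.refl ∷ hp) = coeff-[]-homogeneous d hp

  ш-constantˡ : ∀ {p} → Homogeneous 0 p → ∀ q → p ш q ≋ coeff [] p · q
  ш-constantˡ {p} hp q w = begin
    coeff w (p ш q)                              ≈⟨ coeff-ш w p q ⟩
    bilinear (λ u v → count w (shuffleW u v)) p q ≈⟨ bilinear-constant hp ⟩
    coeff [] p * coeff w q                       ≈⟨ coeff-· w (coeff [] p) q ⟨
    coeff w (coeff [] p · q)                     ∎
    where
    bilinear-constant : ∀ {p} → Homogeneous 0 p →
                        bilinear (λ u v → count w (shuffleW u v)) p q ≈ coeff [] p * coeff w q
    bilinear-constant {[]}          []          = sym (zeroˡ _)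
    bilinear-constant {(r , []) ∷ p} (≡.refl ∷ hp) = begin
      ∑ q (λ (s , v) → (r * s) * count w (v ∷ [])) + bilinear _ p q
        ≈⟨ +-cong (∑-cong q (λ (s , v) → trans (*-congˡ (count-[-] w v)) (*-assoc r s _))) (bilinear-constant hp) ⟩
      ∑ q (λ (s , v) → r * (s * δ w v)) + coeff [] p * coeff w q
        ≈⟨ +-congʳ (trans (∑-*ˡ q r _) (*-congˡ (sym (coeff-as-∑ w q)))) ⟩
      r * coeff w q + coeff [] p * coeff w q
        ≈⟨ distribʳ (coeff w q) r (coeff [] p) ⟨
      (r + coeff [] p) * coeff w q ∎

  module _ {a} {A : Set a} (F : A → Poly) (linear : ∀ x → Homogeneous 1 (F x)) where

    ∂-prodш : ∀ c xs → ∂ c (prodш (map F xs)) ≋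
              sumP (map (λ (x , ys) → coeff (c ∷ []) (F x) · prodш (map F ys)) (picks xs))
    ∂-prodш c []       w = refl
    ∂-prodш c (x ∷ xs) w = begin
      coeff w (∂ c (F x ш Π xs))
        ≈⟨ ∂-ш c (F x) (Π xs) w ⟩
      coeff w ((∂ c (F x) ш Π xs) ⊕ (F x ш ∂ c (Π xs)))
        ≈⟨ coeff-++ w (∂ c (F x) ш Π xs) (F x ш ∂ c (Π xs)) ⟩
      coeff w (∂ c (F x) ш Π xs) + coeff w (F x ш ∂ c (Π xs))
        ≈⟨ +-cong (ш-constantˡ (∂-homogeneous c 0 (linear x)) (Π xs) w)
                  (ш-congʳ (F x) (∂ c (Π xs)) (sumP (map T (picks xs))) (∂-prodш c xs) w) ⟩
      coeff w (coeff [] (∂ c (F x)) · Π xs) + coeff w (F x ш sumP (map T (picks xs)))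
        ≈⟨ +-cong (trans (coeff-· w (coeff [] (∂ c (F x))) (Π xs)) (*-congʳ (coeff-∂ c [] (F x))))
                  (trans (ш-sumP-·ʳ (F x) (picks xs) (λ (y , _) → b y) (λ (_ , ys) → Π ys) w)
                         (coeff-sumP-· w (picks xs) (λ (y , _) → b y) (λ (_ , ys) → F x ш Π ys))) ⟩
      b x * coeff w (Π xs) + ∑ (picks xs) (λ (y , ys) → b y * coeff w (Π (x ∷ ys)))
        ≡⟨ ∑-picks-∷ x xs b (λ ys → coeff w (Π ys)) ⟨
      ∑ (picks (x ∷ xs)) (λ (y , ys) → b y * coeff w (Π ys))
        ≈⟨ coeff-sumP-· w (picks (x ∷ xs)) (λ (y , _) → b y) (λ (_ , ys) → Π ys) ⟨
      coeff w (sumP (map (λ (y , ys) → b y · Π ys) (picks (x ∷ xs)))) ∎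
      where
      Π : List A → Poly
      Π ys = prodш (map F ys)
      b : A → Carrier
      b y = coeff (c ∷ []) (F y)
      T : A × List A → Poly
      T (y , ys) = b y · Π ys

    coeff-∷-prodш : ∀ c w xs → coeff (c ∷ w) (prodш (map F xs)) ≈
                    ∑ (picks xs) (λ (x , ys) → coeff (c ∷ []) (F x) * coeff w (prodш (map F ys)))
    coeff-∷-prodш c w xs = begin
      coeff (c ∷ w) (prodш (map F xs))  ≈⟨ coeff-∂ c w (prodш (map F xs)) ⟨
      coeff w (∂ c (prodш (map F xs)))  ≈⟨ ∂-prodш c xs w ⟩
      coeff w (sumP (map (λ (x , ys) → coeff (c ∷ []) (F x) · prodш (map F ys)) (picks xs)))
        ≈⟨ coeff-sumP-· w (picks xs) _ _ ⟩
      ∑ (picks xs) (λ (x , ys) → coeff (c ∷ []) (F x) * coeff w (prodш (map F ys))) ∎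

    coeff-[]-prodш-∷ : ∀ x xs → coeff [] (prodш (map F (x ∷ xs))) ≈ 0#
    coeff-[]-prodш-∷ x xs = begin
      coeff [] (F x ш prodш (map F xs))           ≈⟨ coeff-[]-ш (F x) (prodш (map F xs)) ⟩
      coeff [] (F x) * coeff [] (prodш (map F xs)) ≈⟨ *-congʳ (coeff-[]-homogeneous 0 (linear x)) ⟩
      0# * coeff [] (prodш (map F xs))             ≈⟨ zeroˡ _ ⟩
      0#                                          ∎

  coeff-word-≡ : ∀ w → coeff w (word w) ≈ 1#
  coeff-word-≡ w with wordEq? w w
  ... | yes _   = +-identityʳ 1#
  ... | no  w≢w = contradiction ≡.refl w≢w

  coeff-word-≢ : ∀ {u w} → u ≢ w → coeff w (word u) ≈ 0#
  coeff-word-≢ {u} {w} u≢w with wordEq? u w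
  ... | yes u≡w = contradiction u≡w u≢w
  ... | no  _   = refl

  sgn-+ : ∀ a b → sgn (a ℕ.+ b) ≈ sgn a * sgn b
  sgn-+ zero    b = sym (*-identityˡ (sgn b))
  sgn-+ (suc a) b = trans (-‿cong (sgn-+ a b)) (-‿distribˡ-* (sgn a) (sgn b))

  sgn-square : ∀ a → sgn a * sgn a ≈ 1#
  sgn-square zero    = *-identityʳ 1#
  sgn-square (suc a) = begin
    - sgn a * - sgn a        ≈⟨ -‿distribˡ-* (sgn a) (- sgn a) ⟨
    - (sgn a * - sgn a)      ≈⟨ -‿cong (-‿distribʳ-* (sgn a) (sgn a)) ⟨
    - - (sgn a * sgn a)      ≈⟨ -‿involutive (sgn a * sgn a) ⟩
    sgn a * sgn a            ≈⟨ sgn-square a ⟩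
    1#                       ∎

  sgn-double : ∀ k → sgn (k ℕ.+ k) ≈ 1#
  sgn-double k = trans (sgn-+ k k) (sgn-square k)

  sgn-parity : ∀ {a b k k' n} → a ℕ.+ k ≡ b ℕ.+ k' → k ℕ.+ k' ≡ n ℕ.+ n → sgn a ≈ sgn b
  sgn-parity {a} {b} {k} {k'} {n} a+k≡b+k' k+k'≡n+n = begin
    sgn a                          ≈⟨ *-identityʳ (sgn a) ⟨
    sgn a * 1#                     ≈⟨ *-congˡ (sgn-double n) ⟨
    sgn a * sgn (n ℕ.+ n)          ≡⟨ ≡.cong (λ j → sgn a * sgn j) k+k'≡n+n ⟨
    sgn a * sgn (k ℕ.+ k')         ≈⟨ sgn-+ a (k ℕ.+ k') ⟨
    sgn (a ℕ.+ (k ℕ.+ k'))         ≡⟨ ≡.cong sgn (ℕ.+-assoc a k k') ⟨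
    sgn (a ℕ.+ k ℕ.+ k')           ≡⟨ ≡.cong (λ j → sgn (j ℕ.+ k')) a+k≡b+k' ⟩
    sgn (b ℕ.+ k' ℕ.+ k')          ≡⟨ ≡.cong sgn (ℕ.+-assoc b k' k') ⟩
    sgn (b ℕ.+ (k' ℕ.+ k'))        ≈⟨ sgn-+ b (k' ℕ.+ k') ⟩
    sgn b * sgn (k' ℕ.+ k')        ≈⟨ *-congˡ (sgn-double k') ⟩
    sgn b * 1#                     ≈⟨ *-identityʳ (sgn b) ⟩
    sgn b                          ∎

  coeff-[-]-∷ : ∀ c r a p →
                coeff (c ∷ []) ((r , a ∷ []) ∷ p) ≈ (if does (a ≟L c) then r else 0#) + coeff (c ∷ []) p
  coeff-[-]-∷ c r a p with a ≟L c
  ... | yes _ = refl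
  ... | no  _ = sym (+-identityˡ _)

data Even : ℕ → Set where
  zero : Even 0
  2+_  : ∀ {n} → Even n → Even (suc (suc n))

module Matchings (m : ℕ) where
  open ≡ using (refl; sym; trans; cong; cong₂; subst; ≢-sym; module ≡-Reasoning)
  open Data.Nat using (_+_)
  open import Data.List.Relation.Unary.Unique.DecPropositional (_≟_ {m}) using (unique?)

  Pair : Set
  Pair = Alph m

  orient : Pair → Pair
  orient (a , b) = if does (b <? a) then (b , a) else (a , b)

  ⟦_<_⟧ : Fin m → Fin m → ℕ
  ⟦ x < y ⟧ = if does (x <? y) then 1 else 0

  descent : Pair → ℕ
  descent (a , b) = ⟦ b < a ⟧

  descents : List Pair → ℕ
  descents []      = 0
  descents (p ∷ w) = descent p + descents w

  Ascending : Pair → Set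
  Ascending (k , l) = k < l

  _<₁_ : Pair → Pair → Set
  p <₁ q = proj₁ p < proj₁ q

  flat : List Pair → List (Fin m)
  flat []            = []
  flat ((x , y) ∷ w) = x ∷ y ∷ flat w

  ≮∧≢⇒> : ∀ {x y : Fin m} → ¬ x < y → x ≢ y → y < x
  ≮∧≢⇒> x≮y x≢y = Fin.≤∧≢⇒< (ℕ.≮⇒≥ x≮y) (≢-sym x≢y)

  orient-ascending : ∀ {k l} → k < l → orient (k , l) ≡ (k , l)
  orient-ascending {k} {l} k<l rewrite dec-false (l <? k) (Fin.<-asym k<l) = refl

  orient-descending : ∀ {k l} → k < l → orient (l , k) ≡ (k , l)
  orient-descending {k} {l} k<l rewrite dec-true (k <? l) k<l = refl

  orient-inverse : ∀ c {k l} → orient c ≡ (k , l) → c ≡ (k , l) ⊎ c ≡ (l , k)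
  orient-inverse (a , b) eq with does (b <? a)
  ... | true  = inj₂ (cong (λ (x , y) → (y , x)) eq)
  ... | false = inj₁ eq

  orient-is-ascending : ∀ {a b} → a ≢ b → Ascending (orient (a , b))
  orient-is-ascending {a} {b} a≢b with Fin.<-cmp a b
  ... | tri< a<b _   _   = subst Ascending (sym (orient-ascending a<b)) a<b
  ... | tri≈ _   a≡b _   = contradiction a≡b a≢b
  ... | tri> _   _   b<a = subst Ascending (sym (orient-descending b<a)) b<a

  descent-ascending : ∀ {k l} → k < l → descent (k , l) ≡ 0
  descent-ascending {k} {l} k<l rewrite dec-false (l <? k) (Fin.<-asym k<l) = refl

  descent-descending : ∀ {k l} → k < l → descent (l , k) ≡ 1
  descent-descending {k} {l} k<l rewrite dec-true (k <? l) k<l = refl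

  descents-ascending : ∀ {P} → All Ascending P → descents P ≡ 0
  descents-ascending []              = refl
  descents-ascending (k<l ∷ ascending) = cong₂ _+_ (descent-ascending k<l) (descents-ascending ascending)

  pairUp-flat : ∀ P → pairUp (flat P) ≡ P
  pairUp-flat []            = refl
  pairUp-flat ((x , y) ∷ P) = cong ((x , y) ∷_) (pairUp-flat P)

  flat-pairUp : ∀ σ → Even (length σ) → flat (pairUp σ) ≡ σ
  flat-pairUp []          zero     = refl
  flat-pairUp (x ∷ y ∷ σ) (2+ even) = cong (λ τ → x ∷ y ∷ τ) (flat-pairUp σ even)

  flat-↭ : ∀ {P Q} → P ↭ Q → flat P ↭ flat Q
  flat-↭ ↭.refl                       = ↭-refl
  flat-↭ (prep (x , y) P↭Q)           = prep x (prep y (flat-↭ P↭Q))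
  flat-↭ (swap (x , y) (x' , y') P↭Q) =
    ↭-trans (↭.shifts (x ∷ y ∷ []) (x' ∷ y' ∷ [])) (prep x' (prep y' (prep x (prep y (flat-↭ P↭Q)))))
  flat-↭ (↭.trans P↭Q Q↭R)            = ↭-trans (flat-↭ P↭Q) (flat-↭ Q↭R)

  flat-orient : ∀ w → flat (map orient w) ↭ flat w
  flat-orient []            = ↭-refl
  flat-orient ((a , b) ∷ w) with does (b <? a)
  ... | true  = swap b a (flat-orient w)
  ... | false = prep a (prep b (flat-orient w))

  Unique-flat⇒firsts-distinct : ∀ {P} → Unique (flat P) → AllPairs (λ p q → proj₁ p ≢ proj₁ q) P
  Unique-flat⇒firsts-distinct {[]}          []                          = []
  Unique-flat⇒firsts-distinct {(x , y) ∷ P} ((_ ∷ x∉P) ∷ (_ ∷ unique)) =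
    firsts x∉P ∷ Unique-flat⇒firsts-distinct unique
    where
    firsts : ∀ {x Q} → All (x ≢_) (flat Q) → All (λ q → x ≢ proj₁ q) Q
    firsts {Q = []}    []              = []
    firsts {Q = _ ∷ _} (x≢a ∷ _ ∷ x∉Q) = x≢a ∷ firsts x∉Q

  Unique-flat⇒Unique : ∀ {P} → Unique (flat P) → Unique P
  Unique-flat⇒Unique unique =
    AllPairs.map (λ x≢y p≡q → x≢y (cong proj₁ p≡q)) (Unique-flat⇒firsts-distinct unique)

  Unique-flat⇒orient-ascending : ∀ w → Unique (flat w) → All Ascending (map orient w)
  Unique-flat⇒orient-ascending []            []                        = []
  Unique-flat⇒orient-ascending ((a , b) ∷ w) ((a≢b ∷ _) ∷ (_ ∷ unique)) =
    orient-is-ascending a≢b ∷ Unique-flat⇒orient-ascending w unique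

  SortedByFirst : List Pair → Set
  SortedByFirst = Linked _<₁_

  ⌊⌋-true : ∀ {P : Set} (P? : Dec P) → P → ⌊ P? ⌋ ≡ true
  ⌊⌋-true P? p = trans (isYes≗does P?) (dec-true P? p)

  pfCond-sound : ∀ P → pfCond P ≡ true → SortedByFirst P × All Ascending P
  pfCond-sound []                 _  = [] , []
  pfCond-sound (p ∷ [])     eq with proj₁ p <? proj₂ p
  ... | yes p-ascending = [-] , (p-ascending ∷ [])
  pfCond-sound (p ∷ q ∷ P) eq = step (proj₁ p <? proj₂ p) (proj₁ p <? proj₁ q) eq (pfCond-sound (q ∷ P))
    where
    step : (p-ascending? : Dec (Ascending p)) (p<₁q? : Dec (p <₁ q)) →
           ⌊ p-ascending? ⌋ ∧ ⌊ p<₁q? ⌋ ∧ pfCond (q ∷ P) ≡ true →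
           (pfCond (q ∷ P) ≡ true → SortedByFirst (q ∷ P) × All Ascending (q ∷ P)) →
           SortedByFirst (p ∷ q ∷ P) × All Ascending (p ∷ q ∷ P)
    step (yes p-ascending) (yes p<₁q) eq′ sound with sound eq′
    ... | sorted , ascending = (p<₁q ∷ sorted) , (p-ascending ∷ ascending)

  pfCond-complete : ∀ P → SortedByFirst P → All Ascending P → pfCond P ≡ true
  pfCond-complete []                        _                  _                   = refl
  pfCond-complete ((x , y) ∷ [])            _                  (x<y ∷ [])          = ⌊⌋-true (x <? y) x<y
  pfCond-complete ((x , y) ∷ (x' , y') ∷ P) (x<x' ∷ sorted) (x<y ∷ ascending)
    rewrite ⌊⌋-true (x <? y) x<y | ⌊⌋-true (x <? x') x<x' = pfCond-complete ((x' , y') ∷ P) sorted ascending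

  insert : Pair → List Pair → List Pair
  insert p []      = p ∷ []
  insert p (q ∷ P) with proj₁ p <? proj₁ q
  ... | yes _ = p ∷ q ∷ P
  ... | no  _ = q ∷ insert p P

  sortByFirst : List Pair → List Pair
  sortByFirst = foldr insert []

  insert-↭ : ∀ p P → insert p P ↭ p ∷ P
  insert-↭ p []      = ↭-refl
  insert-↭ p (q ∷ P) with proj₁ p <? proj₁ q
  ... | yes _ = ↭-refl
  ... | no  _ = ↭-trans (prep q (insert-↭ p P)) (swap q p ↭-refl)

  sortByFirst-↭ : ∀ P → sortByFirst P ↭ P
  sortByFirst-↭ []      = ↭-refl
  sortByFirst-↭ (p ∷ P) = ↭-trans (insert-↭ p (sortByFirst P)) (prep p (sortByFirst-↭ P))

  insert-sorted : ∀ p {P} → SortedByFirst P → All (λ q → proj₁ p ≢ proj₁ q) P → SortedByFirst (insert p P)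
  insert-sorted p {[]}    _      _                = [-]
  insert-sorted p {q ∷ P} sorted (p≢q ∷ p∉P) with proj₁ p <? proj₁ q
  ... | yes p<₁q = p<₁q ∷ sorted
  ... | no  p≮₁q = behind (≮∧≢⇒> p≮₁q p≢q) sorted p∉P
    where
    behind : ∀ {q Q} → q <₁ p → SortedByFirst (q ∷ Q) → All (λ r → proj₁ p ≢ proj₁ r) Q →
             SortedByFirst (q ∷ insert p Q)
    behind {Q = []}    q<₁p _                   _           = q<₁p ∷ [-]
    behind {Q = r ∷ Q} q<₁p (q<₁r ∷ sorted′) (p≢r ∷ p∉Q) with proj₁ p <? proj₁ r
    ... | yes p<₁r = q<₁p ∷ p<₁r ∷ sorted′
    ... | no  p≮₁r = q<₁r ∷ behind (≮∧≢⇒> p≮₁r p≢r) sorted′ p∉Q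

  sortByFirst-sorted : ∀ {P} → AllPairs (λ p q → proj₁ p ≢ proj₁ q) P → SortedByFirst (sortByFirst P)
  sortByFirst-sorted {[]}    []             = []
  sortByFirst-sorted {p ∷ P} (p∉P ∷ distinct) =
    insert-sorted p (sortByFirst-sorted distinct) (↭.All-resp-↭ (↭-sym (sortByFirst-↭ P)) p∉P)

  sorted-↭-unique : ∀ {P Q} → SortedByFirst P → SortedByFirst Q → P ↭ Q → P ≡ Q
  sorted-↭-unique {[]}    {[]}    _ _ _   = refl
  sorted-↭-unique {[]}    {q ∷ Q} _ _ P↭Q = contradiction (↭-sym P↭Q) ↭.¬x∷xs↭[]
  sorted-↭-unique {p ∷ P} {[]}    _ _ P↭Q = contradiction P↭Q ↭.¬x∷xs↭[]
  sorted-↭-unique {p ∷ P} {q ∷ Q} sortedP sortedQ P↭Q with heads-equal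
    where
    below-head : ∀ {r R} → SortedByFirst (r ∷ R) → All (r <₁_) R
    below-head [-]          = []
    below-head (r<₁s ∷ sorted) = r<₁s ∷ All.map (Fin.<-trans r<₁s) (below-head sorted)
    heads-equal : p ≡ q
    heads-equal with ↭.∈-resp-↭ P↭Q (here refl) | ↭.∈-resp-↭ (↭-sym P↭Q) (here refl)
    ... | here p≡q    | _           = p≡q
    ... | there _     | here q≡p    = sym q≡p
    ... | there p∈Q   | there q∈P   =
      contradiction (All.lookup (below-head sortedQ) p∈Q) (Fin.<-asym (All.lookup (below-head sortedP) q∈P))
  ... | refl = cong (p ∷_) (sorted-↭-unique (Linked.tail sortedP) (Linked.tail sortedQ) (↭.drop-∷ P↭Q))

  any-≟-false⇒fresh : ∀ {x : Fin m} ys → any (λ y → ⌊ y ≟ x ⌋) ys ≡ false → All (x ≢_) ys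
  any-≟-false⇒fresh {x} []       _  = []
  any-≟-false⇒fresh {x} (y ∷ ys) eq with y ≟ x
  ... | no y≢x = ≢-sym y≢x ∷ any-≟-false⇒fresh ys eq

  fresh⇒any-≟-false : ∀ {x} {ys : List (Fin m)} → All (x ≢_) ys → any (λ y → ⌊ y ≟ x ⌋) ys ≡ false
  fresh⇒any-≟-false {x} {[]}     []          = refl
  fresh⇒any-≟-false {x} {y ∷ ys} (x≢y ∷ x∉ys) with y ≟ x
  ... | yes y≡x = contradiction (sym y≡x) x≢y
  ... | no  _   = fresh⇒any-≟-false x∉ys

  distinct-sound : ∀ (xs : List (Fin m)) → distinct xs ≡ true → Unique xs
  distinct-sound []       _  = []
  distinct-sound (x ∷ xs) eq with any (λ y → ⌊ y ≟ x ⌋) xs in fresh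
  ... | false = any-≟-false⇒fresh xs fresh ∷ distinct-sound xs eq

  distinct-complete : ∀ {xs : List (Fin m)} → Unique xs → distinct xs ≡ true
  distinct-complete {[]}     []              = refl
  distinct-complete {x ∷ xs} (x∉xs ∷ unique) rewrite fresh⇒any-≟-false x∉xs = distinct-complete unique

  below : Fin m → List (Fin m) → ℕ
  below x xs = length (filter (_<? x) xs)

  below-∷ : ∀ x a xs → below x (a ∷ xs) ≡ ⟦ a < x ⟧ + below x xs
  below-∷ x a xs with does (a <? x)
  ... | true  = refl
  ... | false = refl

  below-↭ : ∀ x {xs ys} → xs ↭ ys → below x xs ≡ below x ys
  below-↭ x xs↭ys = ↭.↭-length (↭.filter-↭ (_<? x) xs↭ys)

  ⟦<⟧-flip : ∀ {x y} → x ≢ y → ⟦ x < y ⟧ + ⟦ y < x ⟧ ≡ 1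
  ⟦<⟧-flip {x} {y} x≢y with Fin.<-cmp x y
  ... | tri< x<y _   _   rewrite dec-true (x <? y) x<y | dec-false (y <? x) (Fin.<-asym x<y) = refl
  ... | tri≈ _   x≡y _   = contradiction x≡y x≢y
  ... | tri> _   _   y<x rewrite dec-false (x <? y) (Fin.<-asym y<x) | dec-true (y <? x) y<x = refl

  belowPair : Pair → List Pair → ℕ
  belowPair (x , y) P = below x (flat P) + below y (flat P)

  crossInversions : List Pair → ℕ
  crossInversions []      = 0
  crossInversions (p ∷ P) = belowPair p P + crossInversions P

  inversions-flat : ∀ w → inversions (flat w) ≡ descents w + crossInversions w
  inversions-flat []            = refl
  inversions-flat ((x , y) ∷ w) rewrite below-∷ x y (flat w) | inversions-flat w =
    regroup ⟦ y < x ⟧ (below x (flat w)) (below y (flat w)) (descents w) (crossInversions w)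
    where
    regroup : ∀ a b c d e → (a + b) + (c + (d + e)) ≡ (a + d) + ((b + c) + e)
    regroup = solve-∀

  belowPair-orient : ∀ p P → belowPair (orient p) (map orient P) ≡ belowPair p P
  belowPair-orient (a , b) P with does (b <? a)
  ... | true  = trans (cong₂ _+_ (below-↭ b (flat-orient P)) (below-↭ a (flat-orient P)))
                      (ℕ.+-comm (below b (flat P)) (below a (flat P)))
  ... | false = cong₂ _+_ (below-↭ a (flat-orient P)) (below-↭ b (flat-orient P))

  crossInversions-orient : ∀ w → crossInversions (map orient w) ≡ crossInversions w
  crossInversions-orient []      = refl
  crossInversions-orient (p ∷ w) = cong₂ _+_ (belowPair-orient p w) (crossInversions-orient w)

  belowPair-↭ : ∀ p {P Q} → P ↭ Q → belowPair p P ≡ belowPair p Q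
  belowPair-↭ (x , y) P↭Q = cong₂ _+_ (below-↭ x (flat-↭ P↭Q)) (below-↭ y (flat-↭ P↭Q))

  pairCross : Pair → Pair → ℕ
  pairCross (a , b) (c , d) = (⟦ c < a ⟧ + ⟦ d < a ⟧) + (⟦ c < b ⟧ + ⟦ d < b ⟧)

  belowPair-∷ : ∀ p q P → belowPair p (q ∷ P) ≡ pairCross p q + belowPair p P
  belowPair-∷ (a , b) (c , d) P
    rewrite below-∷ a c (d ∷ flat P) | below-∷ a d (flat P) | below-∷ b c (d ∷ flat P) | below-∷ b d (flat P) =
    regroup ⟦ c < a ⟧ ⟦ d < a ⟧ (below a (flat P)) ⟦ c < b ⟧ ⟦ d < b ⟧ (below b (flat P))
    where
    regroup : ∀ x₁ x₂ x₃ y₁ y₂ y₃ →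
              (x₁ + (x₂ + x₃)) + (y₁ + (y₂ + y₃)) ≡ ((x₁ + x₂) + (y₁ + y₂)) + (x₃ + y₃)
    regroup = solve-∀

  pairCross-flip : ∀ {a b c d} → a ≢ c → a ≢ d → b ≢ c → b ≢ d →
                   pairCross (a , b) (c , d) + pairCross (c , d) (a , b) ≡ 2 + 2
  pairCross-flip {a} {b} {c} {d} a≢c a≢d b≢c b≢d = begin
    pairCross (a , b) (c , d) + pairCross (c , d) (a , b)
      ≡⟨ regroup ⟦ c < a ⟧ ⟦ d < a ⟧ ⟦ c < b ⟧ ⟦ d < b ⟧
                 ⟦ a < c ⟧ ⟦ b < c ⟧ ⟦ a < d ⟧ ⟦ b < d ⟧ ⟩
    (⟦ c < a ⟧ + ⟦ a < c ⟧) + (⟦ d < a ⟧ + ⟦ a < d ⟧) +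
    ((⟦ c < b ⟧ + ⟦ b < c ⟧) + (⟦ d < b ⟧ + ⟦ b < d ⟧))
      ≡⟨ cong₂ _+_ (cong₂ _+_ (⟦<⟧-flip (≢-sym a≢c)) (⟦<⟧-flip (≢-sym a≢d)))
                   (cong₂ _+_ (⟦<⟧-flip (≢-sym b≢c)) (⟦<⟧-flip (≢-sym b≢d))) ⟩
    2 + 2 ∎
    where
    open ≡-Reasoning
    regroup : ∀ x₁ x₂ x₃ x₄ y₁ y₂ y₃ y₄ →
              ((x₁ + x₂) + (x₃ + x₄)) + ((y₁ + y₂) + (y₃ + y₄)) ≡
              (x₁ + y₁) + (x₂ + y₃) + ((x₃ + y₂) + (x₄ + y₄))
    regroup = solve-∀

  crossInversions-swap : ∀ p q P →
    crossInversions (p ∷ q ∷ P) + pairCross q p ≡ crossInversions (q ∷ p ∷ P) + pairCross p q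
  crossInversions-swap p q P rewrite belowPair-∷ p q P | belowPair-∷ q p P =
    regroup (pairCross p q) (pairCross q p) (belowPair p P) (belowPair q P) (crossInversions P)
    where
    regroup : ∀ x y a b z → ((x + a) + (b + z)) + y ≡ ((y + b) + (a + z)) + x
    regroup = solve-∀

  IsPermutation : List (Fin m) → Set
  IsPermutation σ = length σ ≡ m × Unique σ

  IsPermutation-↭ : ∀ {σ τ} → σ ↭ τ → IsPermutation σ → IsPermutation τ
  IsPermutation-↭ σ↭τ (length≡m , unique) = trans (sym (↭.↭-length σ↭τ)) length≡m , Unique-↭ σ↭τ unique

  isPermutation? : ∀ σ → Dec (IsPermutation σ)
  isPermutation? σ = (length σ ℕ.≟ m) ×-dec unique? σ

module PermutationSums {c ℓ} (R : CommutativeRing c ℓ) (m : ℕ) where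
  open CommutativeRing R
  open ListSum R
  open Matchings m using (IsPermutation; distinct-sound; distinct-complete)
  open import Relation.Binary.Reasoning.Setoid setoid

  ∑-allLists-zero : ∀ k (h : List (Fin m) → Carrier) → (∀ σ → length σ ≡ k → h σ ≈ 0#) →
                    ∑ (allLists m k) h ≈ 0#
  ∑-allLists-zero zero    h h≈0 = trans (+-identityʳ _) (h≈0 [] ≡.refl)
  ∑-allLists-zero (suc k) h h≈0 = trans (∑-concatMap (allFin m) _ h) (∑-zero (allFin m) (λ {i} _ → extend i))
    where
    extend : ∀ i → ∑ (map (i ∷_) (allLists m k)) h ≈ 0#
    extend i = trans (reflexive (∑-map (allLists m k) (i ∷_) h))
                     (∑-allLists-zero k (h ∘ (i ∷_)) (λ σ |σ|≡k → h≈0 (i ∷ σ) (≡.cong suc |σ|≡k)))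

  ∑-allLists-single : ∀ k (h : List (Fin m) → Carrier) v → length v ≡ k →
                      (∀ σ → length σ ≡ k → σ ≢ v → h σ ≈ 0#) → ∑ (allLists m k) h ≈ h v
  ∑-allLists-single zero    h []      _     _   = +-identityʳ _
  ∑-allLists-single (suc k) h (j ∷ v) |v|≡k h≈0 = begin
    ∑ (allLists m (suc k)) h
      ≈⟨ ∑-concatMap (allFin m) _ h ⟩
    ∑[ i ∈ allFin m ] ∑ (map (i ∷_) (allLists m k)) h
      ≈⟨ ∑-single (allFin⁺ m) (∈-allFin j) (λ {i} _ i≢j → other i i≢j) ⟩
    ∑ (map (j ∷_) (allLists m k)) h
      ≡⟨ ∑-map (allLists m k) (j ∷_) h ⟩
    ∑ (allLists m k) (h ∘ (j ∷_))
      ≈⟨ ∑-allLists-single k (h ∘ (j ∷_)) v (ℕ.suc-injective |v|≡k)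
           (λ σ |σ|≡k σ≢v → h≈0 (j ∷ σ) (≡.cong suc |σ|≡k) (σ≢v ∘ List.∷-injectiveʳ)) ⟩
    h (j ∷ v) ∎
    where
    other : ∀ i → i ≢ j → ∑ (map (i ∷_) (allLists m k)) h ≈ 0#
    other i i≢j = trans (reflexive (∑-map (allLists m k) (i ∷_) h))
                        (∑-allLists-zero k (h ∘ (i ∷_))
                          (λ σ |σ|≡k → h≈0 (i ∷ σ) (≡.cong suc |σ|≡k) (i≢j ∘ List.∷-injectiveˡ)))

  ∑-perms-as-allLists : ∀ h → ∑ (perms m) h ≈ ∑[ σ ∈ allLists m m ] when (distinct σ) (h σ)
  ∑-perms-as-allLists h =
    trans (∑-filter _ (allLists m m) h) (∑-cong (allLists m m) (λ σ → when-≟-true (distinct σ) (h σ)))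

  when-distinct-zero : ∀ (h : List (Fin m) → Carrier) σ → length σ ≡ m → (IsPermutation σ → h σ ≈ 0#) →
                       when (distinct σ) (h σ) ≈ 0#
  when-distinct-zero h σ |σ|≡m h≈0 with distinct σ in eq
  ... | true  = h≈0 (|σ|≡m , distinct-sound σ eq)
  ... | false = refl

  ∑-perms-zero : ∀ h → (∀ σ → IsPermutation σ → h σ ≈ 0#) → ∑ (perms m) h ≈ 0#
  ∑-perms-zero h h≈0 = trans (∑-perms-as-allLists h)
                             (∑-allLists-zero m _ (λ σ |σ|≡m → when-distinct-zero h σ |σ|≡m (h≈0 σ)))

  ∑-perms-single : ∀ h v → IsPermutation v → (∀ σ → IsPermutation σ → σ ≢ v → h σ ≈ 0#) →
                   ∑ (perms m) h ≈ h v
  ∑-perms-single h v (|v|≡m , unique) h≈0 = begin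
    ∑ (perms m) h
      ≈⟨ ∑-perms-as-allLists h ⟩
    ∑[ σ ∈ allLists m m ] when (distinct σ) (h σ)
      ≈⟨ ∑-allLists-single m _ v |v|≡m
           (λ σ |σ|≡m σ≢v → when-distinct-zero h σ |σ|≡m (λ σ-perm → h≈0 σ σ-perm σ≢v)) ⟩
    when (distinct v) (h v)
      ≡⟨ ≡.cong (λ b → when b (h v)) (distinct-complete unique) ⟩
    h v ∎

module PfaffianCoefficients {c ℓ} (R : CommutativeRing c ℓ) (m : ℕ) where
  open CommutativeRing R
  open ShuffleAlgebra R (Alph m) (Alph-≟ m)
  open ShuffleCalculus R (Alph m) (Alph-≟ m)
  open ListSum R
  open PermutationSums R m
  open Matchings m
  open import Relation.Binary.Reasoning.Setoid setoid
  open import Data.List.Membership.DecPropositional (Alph-≟ m) using (_∈?_)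

  entry : Pair → Poly
  entry (k , l) = ((1# , ((k , l) ∷ [])) ∷ []) ⊕ (⊖ ((1# , ((l , k) ∷ [])) ∷ []))

  flipped : ∀ {k l : Fin m} → k < l → (l , k) ≢ (k , l)
  flipped k<l lk≡kl = Fin.<-irrefl (≡.cong proj₂ lk≡kl) k<l

  entry-linear : ∀ p → Homogeneous 1 (entry p)
  entry-linear p = ≡.refl ∷ ≡.refl ∷ []

  matchingProduct : List Pair → Poly
  matchingProduct P = prodш (map entry P)

  coeff-entry : ∀ c k l → coeff (c ∷ []) (entry (k , l)) ≈
                when (does (Alph-≟ m (k , l) c)) 1# + when (does (Alph-≟ m (l , k) c)) (- 1#)
  coeff-entry c k l = begin
    coeff (c ∷ []) (entry (k , l))
      ≈⟨ coeff-[-]-∷ c 1# (k , l) ((- 1# * 1# , (l , k) ∷ []) ∷ []) ⟩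
    when (does (Alph-≟ m (k , l) c)) 1# + coeff (c ∷ []) ((- 1# * 1# , (l , k) ∷ []) ∷ [])
      ≈⟨ +-congˡ (trans (coeff-[-]-∷ c (- 1# * 1#) (l , k) []) (+-identityʳ _)) ⟩
    when (does (Alph-≟ m (k , l) c)) 1# + when (does (Alph-≟ m (l , k) c)) (- 1# * 1#)
      ≈⟨ +-congˡ (when-cong (does (Alph-≟ m (l , k) c)) (*-identityʳ (- 1#))) ⟩
    when (does (Alph-≟ m (k , l) c)) 1# + when (does (Alph-≟ m (l , k) c)) (- 1#) ∎
    where
    when-cong : ∀ b {x y} → x ≈ y → when b x ≈ when b y
    when-cong true  x≈y = x≈y
    when-cong false _   = refl

  coeff-entry-oriented : ∀ c {k l} → k < l → orient c ≡ (k , l) → coeff (c ∷ []) (entry (k , l)) ≈ sgn (descent c)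
  coeff-entry-oriented c {k} {l} k<l orient-c with orient-inverse c orient-c
  ... | inj₁ ≡.refl = begin
    coeff ((k , l) ∷ []) (entry (k , l))
      ≈⟨ coeff-entry (k , l) k l ⟩
    when (does (Alph-≟ m (k , l) (k , l))) 1# + when (does (Alph-≟ m (l , k) (k , l))) (- 1#)
      ≡⟨ ≡.cong₂ (λ b b' → when b 1# + when b' (- 1#))
                 (dec-true (Alph-≟ m (k , l) (k , l)) ≡.refl)
                 (dec-false (Alph-≟ m (l , k) (k , l)) (flipped k<l)) ⟩
    1# + 0#
      ≈⟨ +-identityʳ 1# ⟩
    sgn 0
      ≡⟨ ≡.cong sgn (descent-ascending k<l) ⟨
    sgn (descent (k , l)) ∎
  ... | inj₂ ≡.refl = begin
    coeff ((l , k) ∷ []) (entry (k , l))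
      ≈⟨ coeff-entry (l , k) k l ⟩
    when (does (Alph-≟ m (k , l) (l , k))) 1# + when (does (Alph-≟ m (l , k) (l , k))) (- 1#)
      ≡⟨ ≡.cong₂ (λ b b' → when b 1# + when b' (- 1#))
                 (dec-false (Alph-≟ m (k , l) (l , k)) (flipped k<l ∘ ≡.sym))
                 (dec-true (Alph-≟ m (l , k) (l , k)) ≡.refl) ⟩
    0# + - 1#
      ≈⟨ +-identityˡ (- 1#) ⟩
    sgn 1
      ≡⟨ ≡.cong sgn (descent-descending k<l) ⟨
    sgn (descent (l , k)) ∎

  coeff-entry-disoriented : ∀ c {k l} → k < l → orient c ≢ (k , l) → coeff (c ∷ []) (entry (k , l)) ≈ 0#
  coeff-entry-disoriented c {k} {l} k<l orient-c≢kl = begin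
    coeff (c ∷ []) (entry (k , l))
      ≈⟨ coeff-entry c k l ⟩
    when (does (Alph-≟ m (k , l) c)) 1# + when (does (Alph-≟ m (l , k) c)) (- 1#)
      ≡⟨ ≡.cong₂ (λ b b' → when b 1# + when b' (- 1#))
                 (dec-false (Alph-≟ m (k , l) c) (λ { ≡.refl → orient-c≢kl (orient-ascending k<l) }))
                 (dec-false (Alph-≟ m (l , k) c) (λ { ≡.refl → orient-c≢kl (orient-descending k<l) })) ⟩
    0# + 0#
      ≈⟨ +-identityˡ 0# ⟩
    0# ∎

  disoriented-entries : ∀ c {Q} → All (orient c ≢_) Q → All Ascending Q →
                        All (λ q → coeff (c ∷ []) (entry q) ≈ 0#) Q
  disoriented-entries c fresh ascending =
    All.zipWith (λ (orient-c≢q , q-ascending) → coeff-entry-disoriented c q-ascending orient-c≢q) (fresh , ascending)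

  coeff-∷-matchingProduct-∈ : ∀ c w {P} → Unique P → All Ascending P → (c∈P : orient c ∈ P) →
    coeff (c ∷ w) (matchingProduct P) ≈ coeff (c ∷ []) (entry (orient c)) * coeff w (matchingProduct (P ─ c∈P))
  coeff-∷-matchingProduct-∈ c w {P} unique ascending c∈P = begin
    coeff (c ∷ w) (matchingProduct P)
      ≈⟨ coeff-∷-prodш entry entry-linear c w P ⟩
    ∑ (picks P) (λ (p , Q) → coeff (c ∷ []) (entry p) * coeff w (matchingProduct Q))
      ≈⟨ ∑-picks-∈ (λ Q → coeff w (matchingProduct Q)) c∈P
           (disoriented-entries c (Unique⇒fresh-─ unique c∈P) (All.─⁺ c∈P ascending)) ⟩
    coeff (c ∷ []) (entry (orient c)) * coeff w (matchingProduct (P ─ c∈P)) ∎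

  coeff-∷-matchingProduct-∉ : ∀ c w {P} → All Ascending P → orient c ∉ P →
                              coeff (c ∷ w) (matchingProduct P) ≈ 0#
  coeff-∷-matchingProduct-∉ c w {P} ascending c∉P = begin
    coeff (c ∷ w) (matchingProduct P)
      ≈⟨ coeff-∷-prodш entry entry-linear c w P ⟩
    ∑ (picks P) (λ (p , Q) → coeff (c ∷ []) (entry p) * coeff w (matchingProduct Q))
      ≈⟨ ∑-picks-zero (λ Q → coeff w (matchingProduct Q))
                      (disoriented-entries c (All.¬Any⇒All¬ P c∉P) ascending) ⟩
    0# ∎

  coeff-matching : ∀ w P → Unique P → All Ascending P → map orient w ↭ P →
                   coeff w (matchingProduct P) ≈ sgn (descents w)
  coeff-matching []      P unique ascending []↭P with ↭.↭-empty-inv (↭-sym []↭P)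
  ... | ≡.refl = +-identityʳ 1#
  coeff-matching (c ∷ w) P unique ascending w↭P = begin
    coeff (c ∷ w) (matchingProduct P)
      ≈⟨ coeff-∷-matchingProduct-∈ c w unique ascending c∈P ⟩
    coeff (c ∷ []) (entry (orient c)) * coeff w (matchingProduct (P ─ c∈P))
      ≈⟨ *-cong (coeff-entry-oriented c (All.lookup ascending c∈P) ≡.refl)
                (coeff-matching w (P ─ c∈P) (Unique-─ unique c∈P) (All.─⁺ c∈P ascending)
                                (↭.drop-∷ (↭-trans w↭P (─-↭ c∈P)))) ⟩
    sgn (descent c) * sgn (descents w)
      ≈⟨ sgn-+ (descent c) (descents w) ⟨
    sgn (descents (c ∷ w)) ∎
    where
    c∈P : orient c ∈ P
    c∈P = ↭.∈-resp-↭ w↭P (here ≡.refl)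

  coeff-mismatching : ∀ w P → Unique P → All Ascending P → ¬ (map orient w ↭ P) →
                      coeff w (matchingProduct P) ≈ 0#
  coeff-mismatching []      []      _      _         []≁P = contradiction ↭-refl []≁P
  coeff-mismatching []      (p ∷ P) _      _         _    = coeff-[]-prodш-∷ entry entry-linear p P
  coeff-mismatching (c ∷ w) P       unique ascending w≁P with orient c ∈? P
  ... | no  c∉P = coeff-∷-matchingProduct-∉ c w ascending c∉P
  ... | yes c∈P = begin
    coeff (c ∷ w) (matchingProduct P)
      ≈⟨ coeff-∷-matchingProduct-∈ c w unique ascending c∈P ⟩
    coeff (c ∷ []) (entry (orient c)) * coeff w (matchingProduct (P ─ c∈P))
      ≈⟨ *-congˡ (coeff-mismatching w (P ─ c∈P) (Unique-─ unique c∈P) (All.─⁺ c∈P ascending)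
                   (λ w↭P─c → w≁P (↭-trans (prep (orient c) w↭P─c) (↭-sym (─-↭ c∈P))))) ⟩
    coeff (c ∷ []) (entry (orient c)) * 0#
      ≈⟨ zeroʳ _ ⟩
    0# ∎

  -- Swapping two disjoint pairs trades pairCross p q for pairCross q p, and these add up to 4.
  sgn-crossInversions-swap : ∀ p q P → Unique (flat (p ∷ q ∷ P)) →
                             sgn (crossInversions (p ∷ q ∷ P)) ≈ sgn (crossInversions (q ∷ p ∷ P))
  sgn-crossInversions-swap (a , b) (c , d) P ((_ ∷ a≢c ∷ a≢d ∷ _) ∷ (b≢c ∷ b≢d ∷ _) ∷ _) =
    sgn-parity {crossInversions ((a , b) ∷ (c , d) ∷ P)} {crossInversions ((c , d) ∷ (a , b) ∷ P)} {n = 2}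
               (crossInversions-swap (a , b) (c , d) P)
               (≡.trans (ℕ.+-comm (pairCross (c , d) (a , b)) _) (pairCross-flip a≢c a≢d b≢c b≢d))

  sgn-crossInversions-prep : ∀ p {P Q} → P ↭ Q → sgn (crossInversions P) ≈ sgn (crossInversions Q) →
                             sgn (crossInversions (p ∷ P)) ≈ sgn (crossInversions (p ∷ Q))
  sgn-crossInversions-prep p {P} {Q} P↭Q sgn-P≈sgn-Q = begin
    sgn (belowPair p P ℕ.+ crossInversions P)       ≈⟨ sgn-+ (belowPair p P) (crossInversions P) ⟩
    sgn (belowPair p P) * sgn (crossInversions P)
      ≈⟨ *-cong (reflexive (≡.cong sgn (belowPair-↭ p P↭Q))) sgn-P≈sgn-Q ⟩
    sgn (belowPair p Q) * sgn (crossInversions Q)   ≈⟨ sgn-+ (belowPair p Q) (crossInversions Q) ⟨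
    sgn (belowPair p Q ℕ.+ crossInversions Q)       ∎

  sgn-crossInversions-↭ : ∀ {P Q} → P ↭ Q → Unique (flat P) → sgn (crossInversions P) ≈ sgn (crossInversions Q)
  sgn-crossInversions-↭ ↭.refl                 _ = refl
  sgn-crossInversions-↭ (↭.prep p P↭Q)         (_ ∷ _ ∷ unique) =
    sgn-crossInversions-prep p P↭Q (sgn-crossInversions-↭ P↭Q unique)
  sgn-crossInversions-↭ {p ∷ q ∷ P} (↭.swap p q P↭Q) unique@(_ ∷ _ ∷ _ ∷ _ ∷ uniqueP) =
    trans (sgn-crossInversions-swap p q P unique)
          (sgn-crossInversions-prep q (prep p P↭Q)
            (sgn-crossInversions-prep p P↭Q (sgn-crossInversions-↭ P↭Q uniqueP)))
  sgn-crossInversions-↭ (↭.trans P↭Q Q↭R)      unique =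
    trans (sgn-crossInversions-↭ P↭Q unique) (sgn-crossInversions-↭ Q↭R (Unique-↭ (flat-↭ P↭Q) unique))

  sgn-inversions-flat : ∀ w P → All Ascending P → map orient w ↭ P → Unique (flat P) →
                        sgn (inversions (flat P)) * sgn (descents w) ≈ sgn (inversions (flat w))
  sgn-inversions-flat w P ascending w↭P unique = begin
    sgn (inversions (flat P)) * sgn (descents w)
      ≡⟨ ≡.cong (λ n → sgn n * sgn (descents w))
                (≡.trans (inversions-flat P) (≡.cong (ℕ._+ crossInversions P) (descents-ascending ascending))) ⟩
    sgn (crossInversions P) * sgn (descents w)
      ≈⟨ *-congʳ (sgn-crossInversions-↭ (↭-sym w↭P) unique) ⟩
    sgn (crossInversions (map orient w)) * sgn (descents w)
      ≡⟨ ≡.cong (λ n → sgn n * sgn (descents w)) (crossInversions-orient w) ⟩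
    sgn (crossInversions w) * sgn (descents w)
      ≈⟨ *-comm _ _ ⟩
    sgn (descents w) * sgn (crossInversions w)
      ≈⟨ sgn-+ (descents w) (crossInversions w) ⟨
    sgn (descents w ℕ.+ crossInversions w)
      ≡⟨ ≡.cong sgn (inversions-flat w) ⟨
    sgn (inversions (flat w)) ∎

  signedWords : Poly
  signedWords = sumP (map (λ σ → sgn (inversions σ) · word (pairUp σ)) (perms m))

  pfaffian : Poly
  pfaffian = Pfш m (λ k l → entry (k , l))

  pfaffianTerm : Word → List (Fin m) → Carrier
  pfaffianTerm w σ = when (pfCond (pairUp σ)) (sgn (inversions σ) * coeff w (matchingProduct (pairUp σ)))

  coeff-signedWords : ∀ w → coeff w signedWords ≈ ∑[ σ ∈ perms m ] sgn (inversions σ) * coeff w (word (pairUp σ))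
  coeff-signedWords w = coeff-sumP-· w (perms m) (λ σ → sgn (inversions σ)) (λ σ → word (pairUp σ))

  coeff-pfaffian : ∀ w → coeff w pfaffian ≈ ∑[ σ ∈ perms m ] pfaffianTerm w σ
  coeff-pfaffian w = begin
    coeff w pfaffian
      ≈⟨ coeff-sumP-· w (filter (λ σ → pfCond (pairUp σ) Bool.≟ true) (perms m)) _ _ ⟩
    ∑ (filter (λ σ → pfCond (pairUp σ) Bool.≟ true) (perms m)) term
      ≈⟨ ∑-filter _ (perms m) term ⟩
    ∑[ σ ∈ perms m ] (if does (pfCond (pairUp σ) Bool.≟ true) then term σ else 0#)
      ≈⟨ ∑-cong (perms m) (λ σ → when-≟-true (pfCond (pairUp σ)) (term σ)) ⟩
    ∑[ σ ∈ perms m ] pfaffianTerm w σ ∎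
    where
    term : List (Fin m) → Carrier
    term σ = sgn (inversions σ) * coeff w (matchingProduct (pairUp σ))

  module _ (even : Even m) where

    flat-pairUp-permutation : ∀ {σ} → IsPermutation σ → flat (pairUp σ) ≡ σ
    flat-pairUp-permutation {σ} (|σ|≡m , _) = flat-pairUp σ (≡.subst Even (≡.sym |σ|≡m) even)

    pairUp≡⇒≡flat : ∀ {σ P} → IsPermutation σ → pairUp σ ≡ P → σ ≡ flat P
    pairUp≡⇒≡flat σ-perm ≡.refl = ≡.sym (flat-pairUp-permutation σ-perm)

    orient↭pairUp⇒flat↭ : ∀ w {σ} → IsPermutation σ → map orient w ↭ pairUp σ → flat w ↭ σ
    orient↭pairUp⇒flat↭ w σ-perm w↭P =
      ↭-trans (↭-sym (flat-orient w)) (↭-trans (flat-↭ w↭P) (↭.↭-reflexive (flat-pairUp-permutation σ-perm)))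

    pfCond-structure : ∀ {σ} → IsPermutation σ → pfCond (pairUp σ) ≡ true →
                       SortedByFirst (pairUp σ) × All Ascending (pairUp σ) × Unique (flat (pairUp σ))
    pfCond-structure {σ} σ-perm pf with pfCond-sound (pairUp σ) pf
    ... | sorted , ascending =
      sorted , ascending , ≡.subst Unique (≡.sym (flat-pairUp-permutation σ-perm)) (proj₂ σ-perm)

    coeff-signedWords-permutation : ∀ w → IsPermutation (flat w) → coeff w signedWords ≈ sgn (inversions (flat w))
    coeff-signedWords-permutation w w-perm = begin
      coeff w signedWords
        ≈⟨ coeff-signedWords w ⟩
      ∑[ σ ∈ perms m ] sgn (inversions σ) * coeff w (word (pairUp σ))
        ≈⟨ ∑-perms-single _ (flat w) w-perm vanishes ⟩
      sgn (inversions (flat w)) * coeff w (word (pairUp (flat w)))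
        ≡⟨ ≡.cong (λ u → sgn (inversions (flat w)) * coeff w (word u)) (pairUp-flat w) ⟩
      sgn (inversions (flat w)) * coeff w (word w)
        ≈⟨ trans (*-congˡ (coeff-word-≡ w)) (*-identityʳ _) ⟩
      sgn (inversions (flat w)) ∎
      where
      vanishes : ∀ σ → IsPermutation σ → σ ≢ flat w → sgn (inversions σ) * coeff w (word (pairUp σ)) ≈ 0#
      vanishes σ σ-perm σ≢w = trans (*-congˡ (coeff-word-≢ (σ≢w ∘ pairUp≡⇒≡flat σ-perm))) (zeroʳ _)

    coeff-signedWords-non-permutation : ∀ w → ¬ IsPermutation (flat w) → coeff w signedWords ≈ 0#
    coeff-signedWords-non-permutation w w-non-perm = trans (coeff-signedWords w) (∑-perms-zero _ vanishes)
      where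
      vanishes : ∀ σ → IsPermutation σ → sgn (inversions σ) * coeff w (word (pairUp σ)) ≈ 0#
      vanishes σ σ-perm = trans (*-congˡ (coeff-word-≢ λ pairUp-σ≡w →
        w-non-perm (≡.subst IsPermutation (pairUp≡⇒≡flat σ-perm pairUp-σ≡w) σ-perm))) (zeroʳ _)

    pfaffianTerm-matching : ∀ w {σ} → IsPermutation σ → pfCond (pairUp σ) ≡ true → map orient w ↭ pairUp σ →
                            pfaffianTerm w σ ≈ sgn (inversions (flat w))
    pfaffianTerm-matching w {σ} σ-perm pf w↭P with pfCond-structure σ-perm pf
    ... | _ , ascending , unique rewrite pf = begin
      sgn (inversions σ) * coeff w (matchingProduct (pairUp σ))
        ≈⟨ *-congˡ (coeff-matching w (pairUp σ) (Unique-flat⇒Unique unique) ascending w↭P) ⟩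
      sgn (inversions σ) * sgn (descents w)
        ≡⟨ ≡.cong (λ τ → sgn (inversions τ) * sgn (descents w)) (flat-pairUp-permutation σ-perm) ⟨
      sgn (inversions (flat (pairUp σ))) * sgn (descents w)
        ≈⟨ sgn-inversions-flat w (pairUp σ) ascending w↭P unique ⟩
      sgn (inversions (flat w)) ∎

    pfaffianTerm-mismatching : ∀ w {σ} → IsPermutation σ →
                               (pfCond (pairUp σ) ≡ true → ¬ (map orient w ↭ pairUp σ)) → pfaffianTerm w σ ≈ 0#
    pfaffianTerm-mismatching w {σ} σ-perm mismatch with pfCond (pairUp σ) in pf
    ... | false = refl
    ... | true with pfCond-structure σ-perm pf
    ...   | _ , ascending , unique = trans (*-congˡ (coeff-mismatching w (pairUp σ) (Unique-flat⇒Unique unique)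
                                                                         ascending (mismatch ≡.refl)))
                                           (zeroʳ _)

    coeff-pfaffian-permutation : ∀ w → IsPermutation (flat w) → coeff w pfaffian ≈ sgn (inversions (flat w))
    coeff-pfaffian-permutation w (|w|≡m , w-unique) = begin
      coeff w pfaffian                  ≈⟨ coeff-pfaffian w ⟩
      ∑[ σ ∈ perms m ] pfaffianTerm w σ ≈⟨ ∑-perms-single (pfaffianTerm w) (flat S) S-perm vanishes ⟩
      pfaffianTerm w (flat S)           ≈⟨ pfaffianTerm-matching w S-perm S-pfCond S-matches ⟩
      sgn (inversions (flat w))         ∎
      where
      S : List Pair
      S = sortByFirst (map orient w)
      S↭w : S ↭ map orient w
      S↭w = sortByFirst-↭ (map orient w)
      S-perm : IsPermutation (flat S)
      S-perm = IsPermutation-↭ (↭-sym (↭-trans (flat-↭ S↭w) (flat-orient w))) (|w|≡m , w-unique)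
      S-sorted : SortedByFirst S
      S-sorted = sortByFirst-sorted (Unique-flat⇒firsts-distinct (Unique-↭ (↭-sym (flat-orient w)) w-unique))
      S-ascending : All Ascending S
      S-ascending = ↭.All-resp-↭ (↭-sym S↭w) (Unique-flat⇒orient-ascending w w-unique)
      S-pfCond : pfCond (pairUp (flat S)) ≡ true
      S-pfCond = ≡.trans (≡.cong pfCond (pairUp-flat S)) (pfCond-complete S S-sorted S-ascending)
      S-matches : map orient w ↭ pairUp (flat S)
      S-matches = ≡.subst (map orient w ↭_) (≡.sym (pairUp-flat S)) (↭-sym S↭w)
      vanishes : ∀ σ → IsPermutation σ → σ ≢ flat S → pfaffianTerm w σ ≈ 0#
      vanishes σ σ-perm σ≢S = pfaffianTerm-mismatching w σ-perm λ pf w↭P →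
        σ≢S (pairUp≡⇒≡flat σ-perm (sorted-↭-unique (proj₁ (pfCond-sound (pairUp σ) pf)) S-sorted
                                                   (↭-trans (↭-sym w↭P) (↭-sym S↭w))))

    coeff-pfaffian-non-permutation : ∀ w → ¬ IsPermutation (flat w) → coeff w pfaffian ≈ 0#
    coeff-pfaffian-non-permutation w w-non-perm = trans (coeff-pfaffian w) (∑-perms-zero (pfaffianTerm w) vanishes)
      where
      vanishes : ∀ σ → IsPermutation σ → pfaffianTerm w σ ≈ 0#
      vanishes σ σ-perm = pfaffianTerm-mismatching w σ-perm λ _ w↭P →
        w-non-perm (IsPermutation-↭ (↭-sym (orient↭pairUp⇒flat↭ w σ-perm w↭P)) σ-perm)

    signedWords≋pfaffian : signedWords ≋ pfaffian
    signedWords≋pfaffian w with isPermutation? (flat w)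
    ... | yes w-perm     = trans (coeff-signedWords-permutation w w-perm) (sym (coeff-pfaffian-permutation w w-perm))
    ... | no  w-non-perm = trans (coeff-signedWords-non-permutation w w-non-perm)
                                 (sym (coeff-pfaffian-non-permutation w w-non-perm))

even-double : ∀ n → Even (2 ℕ.* n)
even-double zero    = zero
even-double (suc n) = ≡.subst Even (≡.sym (ℕ.*-suc 2 n)) (2+ even-double n)

mainTheorem2 : ∀ {c ℓ} (R : CommutativeRing c ℓ) (n : ℕ) → 1 ℕ.≤ n →
    let open CommutativeRing R using (1#)
        open ShuffleAlgebra R (Alph (2 ℕ.* n)) (Alph-≟ (2 ℕ.* n))
    in sumP (map (λ σ → sgn (inversions σ) · word (pairUp σ)) (perms (2 ℕ.* n)))
       ≋ Pfш (2 ℕ.* n) (λ k l → ((1# , ((k , l) ∷ [])) ∷ []) ⊕ (⊖ ((1# , ((l , k) ∷ [])) ∷ [])))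
-- The identity holds for n = 0 as well.
mainTheorem2 R n _ = PfaffianCoefficients.signedWords≋pfaffian R (2 ℕ.* n) (even-double n)
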